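{- Let $\mathbf P$ be a property of matroids stable under isomorphism. (1) If $\mathbf P$ is deletion closed, then $(\mathcal M^{\mathbf P}_{\bullet,\bullet},\partial_{\mathrm{del}},\partial_{\mathrm{clp}})$ is a sub-bicomplex of $(\mathcal M_{\bullet,\bullet},\partial_{\mathrm{del}},\partial_{\mathrm{clp}})$. (2) If $\mathbf P$ is contraction closed, then $(\mathcal M^{\mathbf P}_{\bullet,\bullet},\partial_{\mathrm{lp}},\partial_{\mathrm{con}})$ is a sub-bicomplex of $(\mathcal M_{\bullet,\bullet},\partial_{\mathrm{lp}},\partial_{\mathrm{con}})$. (3) If $\mathbf P$ is deletion closed, then $[\mathsf M,\eta]\mapsto[\mathsf M^*,\eta]$ gives a grading-transposing isomorphism between $(\mathcal M^{\mathbf P}_{\bullet,\bullet},\partial_{\mathrm{del}},\partial_{\mathrm{clp}})$ and $(\mathcal M^{\mathbf P^*}_{\bullet,\bullet},\partial_{\mathrm{lp}},\partial_{\mathrm{con}})$.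
   Context: An orientation of a matroid $\mathsf M$ is a generator $\eta$ of $\bigwedge^{|E|}\mathbb{Z}\langle E\rangle$, $E=E(\mathsf M)$. $\mathcal M$ is the $\mathbb{Q}$-vector space spanned by symbols $[\mathsf M,\eta]$ modulo $[\mathsf M,-\eta]=-[\mathsf M,\eta]$ and $[\mathsf M,\eta]=[\mathsf M',\psi_*\eta]$ for every matroid isomorphism $\psi:\mathsf M\to\mathsf M'$ ($\psi_*$ the induced map on top exterior powers), bigraded by $\mathcal M_{k,r}$ (nullity $k$, rank $r$). With $\iota_x$ interior product ($\iota_x(x\wedge\alpha)=\alpha$): $\partial_{\mathrm{del}}[\mathsf M,\eta]=\sum_{x\text{ not a coloop}}[\mathsf M\setminus x,\iota_x\eta]$, $\partial_{\mathrm{clp}}$ the same sum over coloops, $\partial_{\mathrm{con}}[\mathsf M,\eta]=\sum_{x\text{ not a loop}}[\mathsf M/x,\iota_x\eta]$, $\partial_{\mathrm{lp}}$ the same sum over loops; $(\mathcal M_{\bullet,\bullet},\partial_{\mathrm{del}},\partial_{\mathrm{clp}})$ and $(\mathcal M_{\bullet,\bullet},\partial_{\mathrm{lp}},\partial_{\mathrm{con}})$ are bicomplexes. For $\mathbf P$ stable under isomorphism, $\mathcal M^{\mathbf P}_{\bullet,\bullet}$ is the span of classes $[\mathsf M,\eta]$ with $\mathsf M$ having $\mathbf P$, with the induced bigrading; $\mathbf P^*$ is the property "$\mathsf M^*$ has $\mathbf P$" ($\mathsf M^*$ the dual matroid). Deletion closed (resp. contraction closed) means $\mathsf M\setminus x$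 (resp. $\mathsf M/x$) has $\mathbf P$ whenever $\mathsf M$ does, for all $x\in E(\mathsf M)$. A grading-transposing isomorphism $\phi:(C,d_h,d_v)\to(D,\partial_h,\partial_v)$ of bicomplexes is a linear isomorphism with $\phi(C_{k,r})=D_{r,k}$, $\phi\circ d_h=\partial_v\circ\phi$, $\phi\circ d_v=\partial_h\circ\phi$. -}

module Defs where

open import Data.Bool.Base using (Bool; true; false; _∧_; _∨_; not; if_then_else_)
open import Data.Nat.Base using (ℕ; zero; suc; _∸_; _<_; _<ᵇ_; _⊔_)
open import Data.Fin.Base using (Fin; toℕ)
open import Data.Fin.Subset using (Subset; inside; outside; ⁅_⁆; _∈_; _∉_; _⊆_; _∪_; ∣_∣)
import Data.Fin.Subset as Sub
open import Data.Fin.Permutation using (Permutation′; _⟨$⟩ʳ_; _⟨$⟩ˡ_)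
open import Data.Vec.Base using (Vec; []; _∷_; lookup; tabulate; insertAt)
open import Data.List.Base using (List; []; _∷_; map; _++_; foldr; filter; length)
open import Data.List.Base as L using ()
open import Data.Sign.Base using (Sign) renaming (_*_ to _*ˢ_)
import Data.Sign.Base as Sign
open import Data.Rational.Base using (ℚ; 1ℚ; -_) renaming (_+_ to _+ℚ_; _*_ to _*ℚ_)
open import Data.Product.Base using (Σ; ∃; _×_; _,_; proj₁)
open import Relation.Binary.PropositionalEquality using (_≡_)
open import Relation.Nullary using (¬_)
open import Relation.Unary using (Pred)

allFinL : ∀ n → List (Fin n)
allFinL n = Data.Vec.Base.toList (tabulate {n = n} (λ i → i))
  where import Data.Vec.Base

subsets : ∀ n → List (Subset n)
subsets zero    = [] ∷ []
subsets (suc n) = map (inside ∷_) (subsets n) ++ map (outside ∷_) (subsets n)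

anyL allL : ∀ {A : Set} → (A → Bool) → List A → Bool
anyL p = foldr (λ a b → p a ∨ b) false
allL p = foldr (λ a b → p a ∧ b) true

_⊆ᵇ_ : ∀ {n} → Subset n → Subset n → Bool
[]      ⊆ᵇ []      = true
(a ∷ p) ⊆ᵇ (b ∷ q) = (not a ∨ b) ∧ (p ⊆ᵇ q)

∁ : ∀ {n} → Subset n → Subset n
∁ = Sub.∁

-- Matroids on the ground set Fin n, given by their independent sets.
-- (Every finite ground set is in bijection with some Fin n; matroid
-- isomorphism is built into the relations of the space 𝓜 below.)

record RawMatroid (n : ℕ) : Set where
  constructor mkRaw
  field indep : Subset n → Bool
open RawMatroid public

record IsMatroid {n : ℕ} (M : RawMatroid n) : Set where
  field
    I1 : indep M Sub.⊥ ≡ true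
    I2 : ∀ I J → I ⊆ J → indep M J ≡ true → indep M I ≡ true
    I3 : ∀ I J → indep M I ≡ true → indep M J ≡ true → ∣ I ∣ < ∣ J ∣ →
         ∃ λ x → x ∈ J × x ∉ I × indep M (I ∪ ⁅ x ⁆) ≡ true

Matroid : ℕ → Set
Matroid n = Σ (RawMatroid n) IsMatroid

isBasis : ∀ {n} → RawMatroid n → Subset n → Bool
isBasis {n} M B = indep M B ∧ allL (λ J → not ((B ⊆ᵇ J) ∧ indep M J) ∨ (J ⊆ᵇ B)) (subsets n)

rank : ∀ {n} → RawMatroid n → ℕ
rank {n} M = foldr (λ I r → (if indep M I then ∣ I ∣ else 0) ⊔ r) 0 (subsets n)

nullity : ∀ {n} → RawMatroid n → ℕ
nullity {n} M = n ∸ rank M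

loop : ∀ {n} → RawMatroid n → Fin n → Bool
loop M x = not (indep M ⁅ x ⁆)

coloop : ∀ {n} → RawMatroid n → Fin n → Bool
coloop {n} M x = allL (λ B → not (isBasis M B) ∨ lookup B x) (subsets n)

-- deletion and contraction of x ∈ Fin (suc m); the remaining ground set
-- E - x is identified with Fin m by the order preserving map punchIn x.
_∖_ : ∀ {m} → RawMatroid (suc m) → Fin (suc m) → RawMatroid m
M ∖ x = mkRaw (λ I → indep M (insertAt I x outside))

_／_ : ∀ {m} → RawMatroid (suc m) → Fin (suc m) → RawMatroid m
M ／ x = if loop M x then M ∖ x else mkRaw (λ I → indep M (insertAt I x inside))

-- dual matroid: bases are complements of bases, so the independent sets
-- are the sets disjoint from some basis of M
dual : ∀ {n} → RawMatroid n → RawMatroid n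
dual {n} M = mkRaw (λ I → anyL (λ B → isBasis M B ∧ (I ⊆ᵇ ∁ B)) (subsets n))

image : ∀ {n} → Permutation′ n → Subset n → Subset n
image ψ I = tabulate (λ y → lookup I (ψ ⟨$⟩ˡ y))

IsIso : ∀ {n} → Permutation′ n → RawMatroid n → RawMatroid n → Set
IsIso ψ M M′ = ∀ I → indep M′ (image ψ I) ≡ indep M I

parity : ℕ → Sign
parity zero    = Sign.+
parity (suc k) = Sign.opposite (parity k)

inversions : ∀ {n} → Permutation′ n → ℕ
inversions {n} ψ = length (filter (λ ij → Data.Bool.Properties.T? (toℕ (ψ ⟨$⟩ʳ proj₂ ij) <ᵇ toℕ (ψ ⟨$⟩ʳ proj₁ ij)))
  (L.concatMap (λ i → L.map (λ j → (i , j)) (L.filter (λ j → Data.Bool.Properties.T? (toℕ i <ᵇ toℕ j)) (allFinL n))) (allFinL n)))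
  where import Data.Bool.Properties
        open import Data.Product.Base using (proj₂)

-- An orientation of a matroid on Fin n is a generator of ⋀ⁿ ℤ⟨Fin n⟩ ≅ ℤ,
-- i.e. ± e₀ ∧ … ∧ eₙ₋₁, recorded by its Sign.  ψ_* (e₀ ∧ … ∧ eₙ₋₁) =
-- e_{ψ 0} ∧ … ∧ e_{ψ (n-1)} = sgn ψ · (e₀ ∧ … ∧ eₙ₋₁).
sgn : ∀ {n} → Permutation′ n → Sign
sgn ψ = parity (inversions ψ)

-- ι_x (e₀ ∧ … ∧ eₙ) = (-1)^x (e₀ ∧ … ê_x … ∧ eₙ)
ιsign : ∀ {m} → Fin (suc m) → Sign → Sign
ιsign x s = parity (toℕ x) *ˢ s

-- The ℚ-vector space 𝓜: formal ℚ-linear expressions in the symbols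
-- [M , η], modulo the ℚ-vector space axioms and the two relations.

infixl 6 _+ᵗ_
infixr 7 _•_
data Term : Set where
  0ᵗ   : Term
  gen  : ∀ {n} → RawMatroid n → Sign → Term
  _+ᵗ_ : Term → Term → Term
  _•_  : ℚ → Term → Term

infix 4 _≈_
data _≈_ : Term → Term → Set where
  refl′   : ∀ {t} → t ≈ t
  sym′    : ∀ {t u} → t ≈ u → u ≈ t
  trans′  : ∀ {t u v} → t ≈ u → u ≈ v → t ≈ v
  +-cong  : ∀ {t t′ u u′} → t ≈ t′ → u ≈ u′ → t +ᵗ u ≈ t′ +ᵗ u′
  •-cong  : ∀ {q t t′} → t ≈ t′ → q • t ≈ q • t′
  +-assoc : ∀ {t u v} → (t +ᵗ u) +ᵗ v ≈ t +ᵗ (u +ᵗ v)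
  +-comm  : ∀ {t u} → t +ᵗ u ≈ u +ᵗ t
  +-idʳ   : ∀ {t} → t +ᵗ 0ᵗ ≈ t
  +-invʳ  : ∀ {t} → t +ᵗ ((- 1ℚ) • t) ≈ 0ᵗ
  •-distˡ : ∀ {q t u} → q • (t +ᵗ u) ≈ q • t +ᵗ q • u
  •-distʳ : ∀ {p q t} → (p +ℚ q) • t ≈ p • t +ᵗ q • t
  •-assoc : ∀ {p q t} → (p *ℚ q) • t ≈ p • (q • t)
  •-one   : ∀ {t} → 1ℚ • t ≈ t
  rel-orient : ∀ {n} (M : RawMatroid n) (s : Sign) →
               gen M (Sign.opposite s) ≈ (- 1ℚ) • gen M s
  rel-iso : ∀ {n} (M M′ : RawMatroid n) (ψ : Permutation′ n) (s : Sign) →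
            IsIso ψ M M′ → gen M s ≈ gen M′ (sgn ψ *ˢ s)

sumᵗ : List Term → Term
sumᵗ = foldr _+ᵗ_ 0ᵗ

∂[_,_] : (∀ {m} → RawMatroid (suc m) → Fin (suc m) → Bool) →
         (∀ {m} → RawMatroid (suc m) → Fin (suc m) → RawMatroid m) →
         Term → Term
∂[ sel , op ] 0ᵗ = 0ᵗ
∂[ sel , op ] (gen {zero} M s) = 0ᵗ
∂[ sel , op ] (gen {suc m} M s) =
  sumᵗ (map (λ x → if sel M x then gen (op M x) (ιsign x s) else 0ᵗ) (allFinL (suc m)))
∂[ sel , op ] (t +ᵗ u) = ∂[ sel , op ] t +ᵗ ∂[ sel , op ] u
∂[ sel , op ] (q • t) = q • ∂[ sel , op ] t

∂del ∂clp ∂con ∂lp : Term → Term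
∂del = ∂[ (λ M x → not (coloop M x)) , _∖_ ]
∂clp = ∂[ coloop , _∖_ ]
∂con = ∂[ (λ M x → not (loop M x)) , _／_ ]
∂lp  = ∂[ loop , _／_ ]

dualMap : Term → Term
dualMap 0ᵗ = 0ᵗ
dualMap (gen M s) = gen (dual M) s
dualMap (t +ᵗ u) = dualMap t +ᵗ dualMap u
dualMap (q • t) = q • dualMap t

GenPred : Set₁
GenPred = ∀ {n} → RawMatroid n → Set

data Over (Q : GenPred) : Term → Set where
  0ᵗ   : Over Q 0ᵗ
  gen  : ∀ {n} {M : RawMatroid n} (s : Sign) → Q M → Over Q (gen M s)
  _+ᵗ_ : ∀ {t u} → Over Q t → Over Q u → Over Q (t +ᵗ u)
  _•_  : ∀ {t} (q : ℚ) → Over Q t → Over Q (q • t)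

-- the class of t lies in the span of the classes [M , η] with Q M
InSpan : GenPred → Term → Set
InSpan Q t = Σ Term λ u → t ≈ u × Over Q u

Property : Set₁
Property = ∀ {n} → Matroid n → Set

IsoStable : Property → Set
IsoStable P = ∀ {n} (M M′ : Matroid n) (ψ : Permutation′ n) →
              IsIso ψ (proj₁ M) (proj₁ M′) → P M → P M′

DeletionClosed : Property → Set
DeletionClosed P = ∀ {m} (M : Matroid (suc m)) (x : Fin (suc m))
                   (h : IsMatroid (proj₁ M ∖ x)) → P M → P (proj₁ M ∖ x , h)

ContractionClosed : Property → Set
ContractionClosed P = ∀ {m} (M : Matroid (suc m)) (x : Fin (suc m))
                      (h : IsMatroid (proj₁ M ／ x)) → P M → P (proj₁ M ／ x , h)

_* : Property → Property
(P *) M = Σ (IsMatroid (dual (proj₁ M))) λ h → P (dual (proj₁ M) , h)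

HasP : Property → GenPred
HasP P M = Σ (IsMatroid M) λ h → P (M , h)

𝓜 : Property → Term → Set
𝓜 P = InSpan (HasP P)

𝓜[_]_,_ : Property → ℕ → ℕ → Term → Set
𝓜[ P ] k , r = InSpan (λ M → HasP P M × nullity M ≡ k × rank M ≡ r)

-- Deleting a point x of a matroid lowers its nullity by one unless x is a coloop, in which case it
-- lowers the rank by one; contracting x lowers the rank unless x is a loop, in which case it lowers
-- the nullity.  So the four boundary maps send generators of 𝓜^P_{k,r} to combinations of generators
-- of the claimed bidegrees as soon as P is closed under the minors involved.  The real work is that
-- the maps respect the relations of 𝓜: an isomorphism ψ : M → M′ restricts to isomorphisms between
-- the minors at x and at ψ x, and ι_{ψ x} ∘ ψ_* = (ψ − x)_* ∘ ι_x, which is the classical identity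
-- sgn ψ = sgn (ψ − x) · (−1)^(x + ψ x).  For (3), M ↦ M* is an involution exchanging rank with
-- nullity and coloops with loops, and (M ∖ x)* = M* ／ x; this transposes the bigrading and
-- intertwines ∂del with ∂con and ∂clp with ∂lp.

module Submission where

open import Defs
open import Algebra.Bundles using (CommutativeMonoid)
open import Data.Bool.Base using (Bool; true; false; _∧_; _∨_; not; if_then_else_)
open import Data.Bool.Properties
  using (T?; ∧-conicalˡ; ∧-conicalʳ; ∧-comm; ∨-zeroʳ; ∨-identityʳ; ¬-not; not-involutive; if-float)
  renaming (_≟_ to _≟ᵇ_)
open import Data.Empty using (⊥-elim)
open import Data.Fin.Base using (Fin; zero; suc; punchIn; punchOut; toℕ)
open import Data.Fin.Permutation using (Permutation′; _⟨$⟩ʳ_; _⟨$⟩ˡ_; remove; punchIn-permute; inverseˡ; inverseʳ)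
import Data.Fin.Permutation as Permutation
open import Data.Fin.Properties
  using (_≟_; any?; toℕ-injective; punchIn-punchOut; punchOut-punchIn; punchInᵢ≢i; punchIn-injective)
open import Data.Fin.Subset using (Subset; inside; outside; ⁅_⁆; _∪_; _∩_; ∣_∣)
import Data.Fin.Subset as Subset
open import Data.Fin.Subset.Properties using (∪-identityʳ; x∈⁅x⁆; x∈⁅y⁆⇒x≡y; ∣⊥∣≡0; ∣p∣≤n; ∣∁p∣≡n∸∣p∣)
open import Data.List.Base using (List; []; _∷_; map; _++_; foldr; filter; length; concatMap)
open import Data.List.Membership.Propositional using () renaming (_∈_ to _∈ˡ_)
open import Data.List.Membership.Propositional.Properties using (∈-++⁺ˡ; ∈-++⁺ʳ; ∈-map⁺)
open import Data.List.Properties using (filter-++; length-++; map-∘)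
open import Data.List.Relation.Unary.Any using (here; there)
open import Data.Nat.Base using (ℕ; zero; suc; _+_; _∸_; _⊔_; _≤_; _<_; _<ᵇ_; z≤n; s≤s)
open import Data.Nat.ListAction using () renaming (sum to sumˡ)
open import Data.Nat.Properties
  using (+-0-commutativeMonoid; +-mono-≤; +-mono-<-≤; +-monoʳ-≤; +-monoʳ-<; +-cancelʳ-≤; +-suc; +-identityʳ;
         ≤-antisym; ≤-trans; ≤-pred; ≤-reflexive; <⇒≱; suc-injective; m≤m⊔n; m≤n⊔m; ⊔-lub; ⊔-sel;
         m≤n⇒m<n∨m≡n; m<m+n; m+[n∸m]≡n; m∸[m∸n]≡n; ∸-+-assoc; module ≤-Reasoning)
import Data.Nat.Properties as ℕ
open import Data.Nat.Tactic.RingSolver using (solve-∀)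
open import Data.Product.Base using (Σ; ∃; _×_; _,_; proj₁; proj₂)
open import Data.Rational.Base using (1ℚ; -_)
open import Data.Sign.Base using (Sign) renaming (_*_ to _*ˢ_)
import Data.Sign.Base as Sign
open import Data.Sign.Properties using (s*s≡+; *-identityʳ; *-commutativeMonoid)
open import Data.Sum.Base using (_⊎_; inj₁; inj₂; [_,_]′)
open import Data.Vec.Base using (Vec; []; _∷_; lookup; tabulate; toList; insertAt; removeAt)
open import Data.Vec.Properties
  using (lookup-zipWith; lookup-replicate; lookup-map; lookup∘tabulate; tabulate∘lookup; tabulate-cong; tabulate-∘;
         toList-map; map-insertAt; insertAt-lookup; insertAt-punchIn; insertAt-removeAt; removeAt-punchOut;
         []=⇒lookup; lookup⇒[]=)
open import Function.Base using (_∘_; id)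
open import Level using (0ℓ)
open import Relation.Binary.PropositionalEquality
  using (_≡_; _≢_; refl; sym; trans; cong; cong₂; subst; subst₂; module ≡-Reasoning)
import Relation.Binary.Reasoning.Setoid
open import Relation.Nullary using (yes; no; _×-dec_)

open import Algebra.Properties.CommutativeMonoid.Sum +-0-commutativeMonoid
  using (sum; sum-remove; ∑-distrib-+; sum-cong-≗; sum-permute; sum-replicate-zero)
open import Algebra.Solver.CommutativeMonoid *-commutativeMonoid using (solve; _⊕_; _⊜_)


∨-true⁻ : ∀ {a b} → a ∨ b ≡ true → a ≡ true ⊎ b ≡ true
∨-true⁻ {true}  _ = inj₁ refl
∨-true⁻ {false} e = inj₂ e

∨-trueʳ : ∀ a {b} → b ≡ true → a ∨ b ≡ true
∨-trueʳ a refl = ∨-zeroʳ a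

not-true⁻ : ∀ {a} → not a ≡ true → a ≡ false
not-true⁻ {false} _ = refl

true≢false : true ≢ false
true≢false ()

≡true-ext : ∀ {a b} → (a ≡ true → b ≡ true) → (b ≡ true → a ≡ true) → a ≡ b
≡true-ext {true}  {b}     f _ = sym (f refl)
≡true-ext {false} {true}  _ g = g refl
≡true-ext {false} {false} _ _ = refl

⇒ᵇ-elim : ∀ {a c} → not a ∨ c ≡ true → a ≡ true → c ≡ true
⇒ᵇ-elim e refl = e

⇒ᵇ-intro : ∀ a {c} → (a ≡ true → c ≡ true) → not a ∨ c ≡ true
⇒ᵇ-intro true  f = f refl
⇒ᵇ-intro false _ = refl

⇒ᵇ-false⁻ : ∀ {a c} → not a ∨ c ≡ false → a ≡ true × c ≡ false
⇒ᵇ-false⁻ {true} {false} _ = refl , refl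

module _ {A : Set} (p : A → Bool) where

  allL⁻ : ∀ {xs x} → allL p xs ≡ true → x ∈ˡ xs → p x ≡ true
  allL⁻ e (here refl) = ∧-conicalˡ _ _ e
  allL⁻ e (there x∈) = allL⁻ (∧-conicalʳ _ _ e) x∈

  allL⁺ : ∀ xs → (∀ x → p x ≡ true) → allL p xs ≡ true
  allL⁺ []       h = refl
  allL⁺ (x ∷ xs) h = cong₂ _∧_ (h x) (allL⁺ xs h)

  allL-false⁻ : ∀ xs → allL p xs ≡ false → ∃ λ x → p x ≡ false
  allL-false⁻ (x ∷ xs) e with p x in px
  ... | true  = allL-false⁻ xs e
  ... | false = x , px

  anyL⁻ : ∀ xs → anyL p xs ≡ true → ∃ λ x → p x ≡ true
  anyL⁻ (x ∷ xs) e with p x in px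
  ... | true  = x , px
  ... | false = anyL⁻ xs e

  anyL⁺ : ∀ {xs x} → x ∈ˡ xs → p x ≡ true → anyL p xs ≡ true
  anyL⁺ {_ ∷ xs} (here refl) e = cong (_∨ anyL p xs) e
  anyL⁺ {y ∷ _} (there x∈) e = ∨-trueʳ (p y) (anyL⁺ x∈ e)

module _ {A : Set} (g : A → ℕ) where

  foldr-⊔-upper : ∀ {xs x} → x ∈ˡ xs → g x ≤ foldr (λ a r → g a ⊔ r) 0 xs
  foldr-⊔-upper (here refl) = m≤m⊔n _ _
  foldr-⊔-upper {y ∷ _} (there x∈) = ≤-trans (foldr-⊔-upper x∈) (m≤n⊔m (g y) _)

  foldr-⊔-least : ∀ xs {k} → (∀ x → g x ≤ k) → foldr (λ a r → g a ⊔ r) 0 xs ≤ k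
  foldr-⊔-least []       _ = z≤n
  foldr-⊔-least (x ∷ xs) h = ⊔-lub (h x) (foldr-⊔-least xs h)

  foldr-⊔-attained : ∀ xs → let m = foldr (λ a r → g a ⊔ r) 0 xs in m ≡ 0 ⊎ ∃ λ x → m ≡ g x
  foldr-⊔-attained []       = inj₁ refl
  foldr-⊔-attained (x ∷ xs) with ⊔-sel (g x) (foldr (λ a r → g a ⊔ r) 0 xs) | foldr-⊔-attained xs
  ... | inj₁ e | _            = inj₂ (x , e)
  ... | inj₂ e | inj₁ e′      = inj₁ (trans e e′)
  ... | inj₂ e | inj₂ (y , e′) = inj₂ (y , trans e e′)

subsets-complete : ∀ {n} (S : Subset n) → S ∈ˡ subsets n
subsets-complete []            = here refl
subsets-complete {suc n} (true ∷ S)  = ∈-++⁺ˡ (∈-map⁺ (inside ∷_) (subsets-complete S))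
subsets-complete {suc n} (false ∷ S) = ∈-++⁺ʳ (map (inside ∷_) (subsets n)) (∈-map⁺ (outside ∷_) (subsets-complete S))

indicator : Bool → ℕ
indicator b = if b then 1 else 0

count : ∀ {n} → (Fin n → Bool) → ℕ
count f = sum (indicator ∘ f)

-- Subsets are compared through lookup (lookup p ⊑ lookup q) rather than with Data.Fin.Subset._⊆_,
-- since lookup is what the insertAt, removeAt, tabulate and zipWith lemmas of Data.Vec speak about.
_⊑_ : ∀ {n} → (Fin n → Bool) → (Fin n → Bool) → Set
f ⊑ g = ∀ i → f i ≡ true → g i ≡ true

sum-mono-≤ : ∀ {n} {f g : Fin n → ℕ} → (∀ i → f i ≤ g i) → sum f ≤ sum g
sum-mono-≤ {zero}  _ = z≤n
sum-mono-≤ {suc n} h = +-mono-≤ (h zero) (sum-mono-≤ (h ∘ suc))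

indicator-mono : ∀ {a b} → (a ≡ true → b ≡ true) → indicator a ≤ indicator b
indicator-mono {true}  h rewrite h refl = s≤s z≤n
indicator-mono {false} _ = z≤n

count-mono : ∀ {n} {f g : Fin n → Bool} → f ⊑ g → count f ≤ count g
count-mono h = sum-mono-≤ (indicator-mono ∘ h)

count-mono-< : ∀ {n} {f g : Fin n → Bool} → f ⊑ g → ∀ x → f x ≡ false → g x ≡ true → count f < count g
count-mono-< {suc n} {f} {g} h x fx gx =
  subst₂ _<_ (sym (sum-remove {i = x} (indicator ∘ f))) (sym (sum-remove {i = x} (indicator ∘ g)))
    (+-mono-<-≤ (subst₂ (λ a b → indicator a < indicator b) (sym fx) (sym gx) (s≤s z≤n))
                (sum-mono-≤ (indicator-mono ∘ h ∘ punchIn x)))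

count-cong : ∀ {n} {f g : Fin n → Bool} → (∀ i → f i ≡ g i) → count f ≡ count g
count-cong f≗g = sum-cong-≗ (cong indicator ∘ f≗g)

count-split : ∀ {n} (f g : Fin n → Bool) → count f ≡ count (λ i → f i ∧ g i) + count (λ i → f i ∧ not (g i))
count-split f g = trans (sum-cong-≗ (λ i → split (f i) (g i)))
  (∑-distrib-+ (λ i → indicator (f i ∧ g i)) (λ i → indicator (f i ∧ not (g i))))
  where
  split : ∀ a b → indicator a ≡ indicator (a ∧ b) + indicator (a ∧ not b)
  split true  true  = refl
  split true  false = refl
  split false _     = refl

count-disjoint-≤ : ∀ {n} {f g h : Fin n → Bool} → (∀ i → f i ≡ true → g i ≡ false) →
                   f ⊑ h → g ⊑ h → count f + count g ≤ count h
count-disjoint-≤ {f = f} {g} {h} disj f⊑h g⊑h =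
  subst (_≤ count h) (∑-distrib-+ (indicator ∘ f) (indicator ∘ g))
    (sum-mono-≤ λ i → bound (f i) (g i) (h i) (disj i) (f⊑h i) (g⊑h i))
  where
  bound : ∀ a b c → (a ≡ true → b ≡ false) → (a ≡ true → c ≡ true) → (b ≡ true → c ≡ true) →
          indicator a + indicator b ≤ indicator c
  bound true  true  _ d _ _ with d refl
  ... | ()
  bound true  false c _ l _ rewrite l refl = s≤s z≤n
  bound false true  c _ _ r rewrite r refl = s≤s z≤n
  bound false false _ _ _ _ = z≤n

exchange-count : ∀ {n} (I J C D : Fin n → Bool) → (∀ i → J i ≡ true → C i ≡ false) →
                 (λ i → J i ∧ not (I i)) ⊑ D → (λ i → C i ∧ not (I i)) ⊑ D → count D ≡ count C →
                 count J ≤ count I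
exchange-count I J C D J⇒¬C J∖I⊑D C∖I⊑D ∣D∣≡∣C∣ = begin
  count J                                                   ≡⟨ count-split J I ⟩
  count (λ i → J i ∧ I i) + count (λ i → J i ∧ not (I i))
    ≤⟨ +-monoʳ-≤ (count (λ i → J i ∧ I i)) (≤-trans J∖I≤C∩I C∩I≤I∖J) ⟩
  count (λ i → J i ∧ I i) + count (λ i → I i ∧ not (J i))
    ≡⟨ cong (_+ count (λ i → I i ∧ not (J i))) (count-cong (λ i → ∧-comm (J i) (I i))) ⟩
  count (λ i → I i ∧ J i) + count (λ i → I i ∧ not (J i))   ≡⟨ count-split I J ⟨
  count I                                                   ∎
  where
  open ≤-Reasoning
  J∖I≤C∩I : count (λ i → J i ∧ not (I i)) ≤ count (λ i → C i ∧ I i)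
  J∖I≤C∩I = +-cancelʳ-≤ (count (λ i → C i ∧ not (I i))) _ _ (begin
    count (λ i → J i ∧ not (I i)) + count (λ i → C i ∧ not (I i))
      ≤⟨ count-disjoint-≤ (λ i J∖I → cong (_∧ not (I i)) (J⇒¬C i (∧-conicalˡ _ _ J∖I))) J∖I⊑D C∖I⊑D ⟩
    count D                                                   ≡⟨ ∣D∣≡∣C∣ ⟩
    count C                                                   ≡⟨ count-split C I ⟩
    count (λ i → C i ∧ I i) + count (λ i → C i ∧ not (I i))   ∎)
  C∩I≤I∖J : count (λ i → C i ∧ I i) ≤ count (λ i → I i ∧ not (J i))
  C∩I≤I∖J = count-mono λ i C∩I → cong₂ _∧_ (∧-conicalʳ _ _ C∩I) (cong not (¬C⇒¬J i (∧-conicalˡ _ _ C∩I)))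
    where
    ¬C⇒¬J : ∀ i → C i ≡ true → J i ≡ false
    ¬C⇒¬J i Ci with J i in Ji
    ... | false = refl
    ... | true  = ⊥-elim (true≢false (trans (sym Ci) (J⇒¬C i Ji)))

∣p∣≡count : ∀ {n} (p : Subset n) → ∣ p ∣ ≡ count (lookup p)
∣p∣≡count []          = refl
∣p∣≡count (true ∷ p)  = cong suc (∣p∣≡count p)
∣p∣≡count (false ∷ p) = ∣p∣≡count p

lookup-∁ : ∀ {n} (p : Subset n) i → lookup (Subset.∁ p) i ≡ not (lookup p i)
lookup-∁ p i = lookup-map i not p

lookup-∪ : ∀ {n} (p q : Subset n) i → lookup (p ∪ q) i ≡ lookup p i ∨ lookup q i
lookup-∪ p q i = lookup-zipWith _∨_ i p q

lookup-∩ : ∀ {n} (p q : Subset n) i → lookup (p ∩ q) i ≡ lookup p i ∧ lookup q i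
lookup-∩ p q i = lookup-zipWith _∧_ i p q

lookup-⊥ : ∀ {n} (i : Fin n) → lookup (Subset.⊥ {n}) i ≡ false
lookup-⊥ i = lookup-replicate i false

lookup-⁅x⁆-x : ∀ {n} (x : Fin n) → lookup ⁅ x ⁆ x ≡ true
lookup-⁅x⁆-x x = []=⇒lookup (x∈⁅x⁆ x)

lookup-⁅x⁆⁻ : ∀ {n} (x i : Fin n) → lookup ⁅ x ⁆ i ≡ true → i ≡ x
lookup-⁅x⁆⁻ x i e = x∈⁅y⁆⇒x≡y x (lookup⇒[]= i ⁅ x ⁆ e)

lookup-∪⁅x⁆⁻ : ∀ {n} (p : Subset n) x i → lookup (p ∪ ⁅ x ⁆) i ≡ true → lookup p i ≡ true ⊎ i ≡ x
lookup-∪⁅x⁆⁻ p x i e with ∨-true⁻ (trans (sym (lookup-∪ p ⁅ x ⁆ i)) e)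
... | inj₁ i∈p = inj₁ i∈p
... | inj₂ i∈x = inj₂ (lookup-⁅x⁆⁻ x i i∈x)

p⊑p∪⁅x⁆ : ∀ {n} (p : Subset n) x → lookup p ⊑ lookup (p ∪ ⁅ x ⁆)
p⊑p∪⁅x⁆ p x i e = trans (lookup-∪ p ⁅ x ⁆ i) (cong (_∨ _) e)

x∈p∪⁅x⁆ : ∀ {n} (p : Subset n) x → lookup (p ∪ ⁅ x ⁆) x ≡ true
x∈p∪⁅x⁆ p x = trans (lookup-∪ p ⁅ x ⁆ x) (∨-trueʳ (lookup p x) (lookup-⁅x⁆-x x))

lookup-∁⁺ : ∀ {n} (p : Subset n) {i} → lookup p i ≡ false → lookup (∁ p) i ≡ true
lookup-∁⁺ p {i} i∉p = trans (lookup-∁ p i) (cong not i∉p)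

lookup-∁⁻ : ∀ {n} (p : Subset n) {i} → lookup (∁ p) i ≡ true → lookup p i ≡ false
lookup-∁⁻ p {i} i∈∁p = not-true⁻ (trans (sym (lookup-∁ p i)) i∈∁p)

∁-insertAt : ∀ {m} (p : Subset m) x b → ∁ (insertAt p x b) ≡ insertAt (∁ p) x (not b)
∁-insertAt p x b = map-insertAt not b p x

⁅x⁆⊑ : ∀ {n} {p : Subset n} x → lookup p x ≡ true → lookup ⁅ x ⁆ ⊑ lookup p
⁅x⁆⊑ {p = p} x x∈p i i∈⁅x⁆ = subst (λ j → lookup p j ≡ true) (sym (lookup-⁅x⁆⁻ x i i∈⁅x⁆)) x∈p

∪⁅x⁆-⊑ : ∀ {n} {p q : Subset n} x → lookup p ⊑ lookup q → lookup q x ≡ true → lookup (p ∪ ⁅ x ⁆) ⊑ lookup q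
∪⁅x⁆-⊑ {p = p} {q} x p⊑q x∈q i i∈ with lookup-∪⁅x⁆⁻ p x i i∈
... | inj₁ i∈p = p⊑q i i∈p
... | inj₂ refl = x∈q

⊑∁-sym : ∀ {n} (p q : Subset n) → lookup p ⊑ lookup (∁ q) → lookup q ⊑ lookup (∁ p)
⊑∁-sym p q p⊑∁q i i∈q = lookup-∁⁺ p (¬-not λ i∈p → true≢false (trans (sym i∈q) (lookup-∁⁻ q (p⊑∁q i i∈p))))

⊆ᵇ⁻ : ∀ {n} (p q : Subset n) → p ⊆ᵇ q ≡ true → lookup p ⊑ lookup q
⊆ᵇ⁻ (true ∷ p) (true  ∷ q) e  zero    _ = refl
⊆ᵇ⁻ (a    ∷ p) (b     ∷ q) e  (suc i) h = ⊆ᵇ⁻ p q (∧-conicalʳ (not a ∨ b) _ e) i h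
⊆ᵇ⁻ (true ∷ p) (false ∷ q) () zero    _

⊆ᵇ⁺ : ∀ {n} (p q : Subset n) → lookup p ⊑ lookup q → p ⊆ᵇ q ≡ true
⊆ᵇ⁺ []           []      _ = refl
⊆ᵇ⁺ (true  ∷ p) (b ∷ q) s rewrite s zero refl = ⊆ᵇ⁺ p q (s ∘ suc)
⊆ᵇ⁺ (false ∷ p) (b ∷ q) s = ⊆ᵇ⁺ p q (s ∘ suc)

∣p∣≤∣q∣ : ∀ {n} (p q : Subset n) → lookup p ⊑ lookup q → ∣ p ∣ ≤ ∣ q ∣
∣p∣≤∣q∣ p q p⊑q = subst₂ _≤_ (sym (∣p∣≡count p)) (sym (∣p∣≡count q)) (count-mono p⊑q)

p⊑q∧∣q∣≤∣p∣⇒q⊑p : ∀ {n} (p q : Subset n) → lookup p ⊑ lookup q → ∣ q ∣ ≤ ∣ p ∣ → lookup q ⊑ lookup p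
p⊑q∧∣q∣≤∣p∣⇒q⊑p p q p⊑q ∣q∣≤∣p∣ i i∈q with lookup p i in i∈p
... | true  = refl
... | false = ⊥-elim (<⇒≱ ∣p∣<∣q∣ ∣q∣≤∣p∣)
  where
  ∣p∣<∣q∣ = subst₂ _<_ (sym (∣p∣≡count p)) (sym (∣p∣≡count q)) (count-mono-< p⊑q i i∈p i∈q)

∣p∪⁅x⁆∣ : ∀ {n} (p : Subset n) x → lookup p x ≡ false → ∣ p ∪ ⁅ x ⁆ ∣ ≡ suc ∣ p ∣
∣p∪⁅x⁆∣ (false ∷ p) zero    refl = cong (suc ∘ ∣_∣) (∪-identityʳ p)
∣p∪⁅x⁆∣ (true  ∷ p) (suc x) x∉p  = cong suc (∣p∪⁅x⁆∣ p x x∉p)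
∣p∪⁅x⁆∣ (false ∷ p) (suc x) x∉p  = ∣p∪⁅x⁆∣ p x x∉p

punchIn-view : ∀ {m} (x i : Fin (suc m)) → i ≡ x ⊎ ∃ λ j → i ≡ punchIn x j
punchIn-view x i with x ≟ i
... | yes refl = inj₁ refl
... | no  x≢i  = inj₂ (punchOut x≢i , sym (punchIn-punchOut x≢i))

punchIn-elim : ∀ {m} {P : Fin (suc m) → Set} x → P x → (∀ j → P (punchIn x j)) → ∀ i → P i
punchIn-elim x Px Pj i with punchIn-view x i
... | inj₁ refl       = Px
... | inj₂ (j , refl) = Pj j

lookup-ext : ∀ {A : Set} {n} {u v : Vec A n} → (∀ i → lookup u i ≡ lookup v i) → u ≡ v
lookup-ext {u = u} {v} e = trans (sym (tabulate∘lookup u)) (trans (tabulate-cong e) (tabulate∘lookup v))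

lookup-removeAt : ∀ {A : Set} {m} (S : Vec A (suc m)) x j → lookup (removeAt S x) j ≡ lookup S (punchIn x j)
lookup-removeAt S x j =
  trans (cong (lookup (removeAt S x)) (sym (punchOut-punchIn x))) (removeAt-punchOut S (punchInᵢ≢i x j ∘ sym))

insertAt-removeAt′ : ∀ {A : Set} {m} (S : Vec A (suc m)) x {b} → lookup S x ≡ b → insertAt (removeAt S x) x b ≡ S
insertAt-removeAt′ S x refl = insertAt-removeAt S x

∣insertAt∣ : ∀ {m} (I : Subset m) x b → ∣ insertAt I x b ∣ ≡ indicator b + ∣ I ∣
∣insertAt∣ I x b = begin
  ∣ insertAt I x b ∣                   ≡⟨ ∣p∣≡count (insertAt I x b) ⟩
  count (lookup (insertAt I x b))      ≡⟨ sum-remove {i = x} (indicator ∘ lookup (insertAt I x b)) ⟩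
  indicator (lookup (insertAt I x b) x) + count (lookup (insertAt I x b) ∘ punchIn x)
    ≡⟨ cong₂ _+_ (cong indicator (insertAt-lookup I x b)) (count-cong (insertAt-punchIn I x b)) ⟩
  indicator b + count (lookup I)       ≡⟨ cong (indicator b +_) (∣p∣≡count I) ⟨
  indicator b + ∣ I ∣                  ∎
  where open ≡-Reasoning

∣removeAt∣ : ∀ {m} (p : Subset (suc m)) x {b} → lookup p x ≡ b → ∣ p ∣ ≡ indicator b + ∣ removeAt p x ∣
∣removeAt∣ p x {b} x∈p = trans (cong ∣_∣ (sym (insertAt-removeAt′ p x x∈p))) (∣insertAt∣ (removeAt p x) x b)

insertAt-⊑ : ∀ {m} {I J : Subset m} x b → lookup I ⊑ lookup J → lookup (insertAt I x b) ⊑ lookup (insertAt J x b)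
insertAt-⊑ {I = I} {J} x b I⊑J = punchIn-elim x
  (λ e → trans (insertAt-lookup J x b) (trans (sym (insertAt-lookup I x b)) e))
  (λ j e → trans (insertAt-punchIn J x b j) (I⊑J j (trans (sym (insertAt-punchIn I x b j)) e)))

insertAt-⊑⁻ : ∀ {m} {I J : Subset m} x b c → lookup (insertAt I x b) ⊑ lookup (insertAt J x c) → lookup I ⊑ lookup J
insertAt-⊑⁻ {I = I} {J} x b c s j e =
  trans (sym (insertAt-punchIn J x c j)) (s (punchIn x j) (trans (insertAt-punchIn I x b j) e))

insertAt-removeAt-false⊑ : ∀ {m} (B : Subset (suc m)) x → lookup (insertAt (removeAt B x) x false) ⊑ lookup B
insertAt-removeAt-false⊑ B x = punchIn-elim x
  (λ e → ⊥-elim (true≢false (trans (sym e) (insertAt-lookup (removeAt B x) x false))))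
  (λ j e → trans (sym (lookup-removeAt B x j)) (trans (sym (insertAt-punchIn (removeAt B x) x false j)) e))

insertAt-⊥ : ∀ {m} x → insertAt (Subset.⊥ {m}) x false ≡ Subset.⊥
insertAt-⊥ {m} x = lookup-ext (punchIn-elim x
  (trans (insertAt-lookup Subset.⊥ x false) (sym (lookup-⊥ x)))
  (λ j → trans (insertAt-punchIn Subset.⊥ x false j) (trans (lookup-⊥ j) (sym (lookup-⊥ (punchIn x j))))))

insertAt-⊥-true : ∀ {m} x → insertAt (Subset.⊥ {m}) x true ≡ ⁅ x ⁆
insertAt-⊥-true {m} x = lookup-ext (punchIn-elim x
  (trans (insertAt-lookup Subset.⊥ x true) (sym (lookup-⁅x⁆-x x)))
  (λ j → trans (insertAt-punchIn Subset.⊥ x true j)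
           (trans (lookup-⊥ j) (sym (¬-not (punchInᵢ≢i x j ∘ lookup-⁅x⁆⁻ x _))))))

lookup-⁅punchIn⁆ : ∀ {m} (x : Fin (suc m)) y j → lookup ⁅ punchIn x y ⁆ (punchIn x j) ≡ lookup ⁅ y ⁆ j
lookup-⁅punchIn⁆ x y j = ≡true-ext
  (λ e → subst (λ k → lookup ⁅ y ⁆ k ≡ true)
           (sym (punchIn-injective x j y (lookup-⁅x⁆⁻ (punchIn x y) (punchIn x j) e))) (lookup-⁅x⁆-x y))
  (λ e → subst (λ k → lookup ⁅ punchIn x y ⁆ (punchIn x k) ≡ true)
           (sym (lookup-⁅x⁆⁻ y j e)) (lookup-⁅x⁆-x (punchIn x y)))

insertAt-∪⁅⁆ : ∀ {m} (I : Subset m) x b y → insertAt (I ∪ ⁅ y ⁆) x b ≡ insertAt I x b ∪ ⁅ punchIn x y ⁆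
insertAt-∪⁅⁆ I x b y = lookup-ext (punchIn-elim x at-x at-punchIn)
  where
  open ≡-Reasoning
  at-x : lookup (insertAt (I ∪ ⁅ y ⁆) x b) x ≡ lookup (insertAt I x b ∪ ⁅ punchIn x y ⁆) x
  at-x = begin
    lookup (insertAt (I ∪ ⁅ y ⁆) x b) x   ≡⟨ insertAt-lookup _ x b ⟩
    b                                     ≡⟨ ∨-identityʳ b ⟨
    b ∨ false
      ≡⟨ cong₂ _∨_ (insertAt-lookup I x b) (¬-not (punchInᵢ≢i x y ∘ sym ∘ lookup-⁅x⁆⁻ _ x)) ⟨
    lookup (insertAt I x b) x ∨ lookup ⁅ punchIn x y ⁆ x   ≡⟨ lookup-∪ (insertAt I x b) _ x ⟨
    lookup (insertAt I x b ∪ ⁅ punchIn x y ⁆) x            ∎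
  at-punchIn : ∀ j → lookup (insertAt (I ∪ ⁅ y ⁆) x b) (punchIn x j) ≡
                     lookup (insertAt I x b ∪ ⁅ punchIn x y ⁆) (punchIn x j)
  at-punchIn j = begin
    lookup (insertAt (I ∪ ⁅ y ⁆) x b) (punchIn x j)   ≡⟨ insertAt-punchIn _ x b j ⟩
    lookup (I ∪ ⁅ y ⁆) j                              ≡⟨ lookup-∪ I ⁅ y ⁆ j ⟩
    lookup I j ∨ lookup ⁅ y ⁆ j                       ≡⟨ cong₂ _∨_ (insertAt-punchIn I x b j) (lookup-⁅punchIn⁆ x y j) ⟨
    lookup (insertAt I x b) (punchIn x j) ∨ lookup ⁅ punchIn x y ⁆ (punchIn x j)
      ≡⟨ lookup-∪ (insertAt I x b) _ (punchIn x j) ⟨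
    lookup (insertAt I x b ∪ ⁅ punchIn x y ⁆) (punchIn x j)                       ∎

Independent : ∀ {n} → RawMatroid n → Subset n → Set
Independent M I = indep M I ≡ true

module _ {n} (M : RawMatroid n) where

  private
    size : Subset n → ℕ
    size I = if indep M I then ∣ I ∣ else 0

  rank-≥ : ∀ {I} → Independent M I → ∣ I ∣ ≤ rank M
  rank-≥ {I} iI = subst (_≤ rank M) (cong (λ b → if b then ∣ I ∣ else 0) iI) (foldr-⊔-upper size (subsets-complete I))

  rank-≤ : ∀ {k} → (∀ I → Independent M I → ∣ I ∣ ≤ k) → rank M ≤ k
  rank-≤ {k} h = foldr-⊔-least size (subsets n) bound
    where
    bound : ∀ I → size I ≤ k
    bound I with indep M I in iI
    ... | true  = h I iI
    ... | false = z≤n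

  rank-≡ : ∀ {k J} → (∀ I → Independent M I → ∣ I ∣ ≤ k) → Independent M J → ∣ J ∣ ≡ k → rank M ≡ k
  rank-≡ h iJ refl = ≤-antisym (rank-≤ h) (rank-≥ iJ)

  rank-attained : Independent M Subset.⊥ → ∃ λ I → Independent M I × ∣ I ∣ ≡ rank M
  rank-attained i⊥ with foldr-⊔-attained size (subsets n)
  ... | inj₁ r≡0 = Subset.⊥ , i⊥ , trans (∣⊥∣≡0 n) (sym r≡0)
  ... | inj₂ (S , r≡) with indep M S in iS
  ...   | true  = S , iS , sym r≡
  ...   | false = Subset.⊥ , i⊥ , trans (∣⊥∣≡0 n) (sym r≡)

  Maximal : Subset n → Set
  Maximal B = ∀ J → lookup B ⊑ lookup J → Independent M J → lookup J ⊑ lookup B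

  isBasis⁻ : ∀ {B} → isBasis M B ≡ true → Independent M B × Maximal B
  isBasis⁻ {B} e = ∧-conicalˡ _ _ e , λ J B⊑J iJ →
    ⊆ᵇ⁻ J B (⇒ᵇ-elim (allL⁻ _ (∧-conicalʳ _ _ e) (subsets-complete J)) (cong₂ _∧_ (⊆ᵇ⁺ B J B⊑J) iJ))

  isBasis⁺ : ∀ {B} → Independent M B → Maximal B → isBasis M B ≡ true
  isBasis⁺ {B} iB max = cong₂ _∧_ iB (allL⁺ _ (subsets n) λ J →
    ⇒ᵇ-intro ((B ⊆ᵇ J) ∧ indep M J) λ e → ⊆ᵇ⁺ J B (max J (⊆ᵇ⁻ B J (∧-conicalˡ _ _ e)) (∧-conicalʳ _ _ e)))

  dual⁻ : ∀ I → Independent (dual M) I → ∃ λ B → isBasis M B ≡ true × lookup I ⊑ lookup (∁ B)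
  dual⁻ I e with anyL⁻ _ (subsets n) e
  ... | B , h = B , ∧-conicalˡ _ _ h , ⊆ᵇ⁻ I (∁ B) (∧-conicalʳ _ _ h)

  dual⁺ : ∀ I B → isBasis M B ≡ true → lookup I ⊑ lookup (∁ B) → Independent (dual M) I
  dual⁺ I B b I⊑∁B = anyL⁺ _ (subsets-complete B) (cong₂ _∧_ b (⊆ᵇ⁺ I (∁ B) I⊑∁B))

module _ {m} (M : RawMatroid (suc m)) (x : Fin (suc m)) where

  coloop⁻ : coloop M x ≡ true → ∀ {B} → isBasis M B ≡ true → lookup B x ≡ true
  coloop⁻ e {B} = ⇒ᵇ-elim (allL⁻ _ e (subsets-complete B))

  coloop⁺ : (∀ {B} → isBasis M B ≡ true → lookup B x ≡ true) → coloop M x ≡ true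
  coloop⁺ h = allL⁺ _ (subsets (suc m)) λ B → ⇒ᵇ-intro (isBasis M B) h

  coloop-false⁻ : coloop M x ≡ false → ∃ λ B → isBasis M B ≡ true × lookup B x ≡ false
  coloop-false⁻ e with allL-false⁻ _ (subsets (suc m)) e
  ... | B , f = B , ⇒ᵇ-false⁻ f

  nonloop⁻ : loop M x ≡ false → Independent M ⁅ x ⁆
  nonloop⁻ e = trans (sym (not-involutive _)) (cong not e)

module _ {n} {M : RawMatroid n} (isM : IsMatroid M) where
  open IsMatroid isM

  independent-⊑ : ∀ {I J} → lookup I ⊑ lookup J → Independent M J → Independent M I
  independent-⊑ {I} {J} I⊑J = I2 I J (λ {x} x∈I → lookup⇒[]= x J (I⊑J x ([]=⇒lookup x∈I)))

  augment : ∀ {I J} → Independent M I → Independent M J → ∣ I ∣ < ∣ J ∣ →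
            ∃ λ x → lookup J x ≡ true × lookup I x ≡ false × Independent M (I ∪ ⁅ x ⁆)
  augment {I} {J} iI iJ ∣I∣<∣J∣ with I3 I J iI iJ ∣I∣<∣J∣
  ... | x , x∈J , x∉I , iIx = x , []=⇒lookup x∈J , ¬-not (x∉I ∘ lookup⇒[]= x I) , iIx

  Basis : Subset n → Set
  Basis B = Independent M B × ∣ B ∣ ≡ rank M

  basis-exists : ∃ Basis
  basis-exists = rank-attained M I1

  rank≤n : rank M ≤ n
  rank≤n with basis-exists
  ... | B , _ , ∣B∣≡r = subst (_≤ n) ∣B∣≡r (∣p∣≤n B)

  isBasis⇒Basis : ∀ {B} → isBasis M B ≡ true → Basis B
  isBasis⇒Basis {B} b with isBasis⁻ M b
  ... | iB , maxB with m≤n⇒m<n∨m≡n (rank-≥ M iB)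
  ...   | inj₂ ∣B∣≡r = iB , ∣B∣≡r
  ...   | inj₁ ∣B∣<r with basis-exists
  ...     | I , iI , ∣I∣≡r with augment iB iI (subst (∣ B ∣ <_) (sym ∣I∣≡r) ∣B∣<r)
  ...       | x , _ , x∉B , iBx =
    ⊥-elim (true≢false (trans (sym (maxB (B ∪ ⁅ x ⁆) (p⊑p∪⁅x⁆ B x) iBx x (x∈p∪⁅x⁆ B x))) x∉B))

  Basis⇒isBasis : ∀ {B} → Basis B → isBasis M B ≡ true
  Basis⇒isBasis {B} (iB , ∣B∣≡r) = isBasis⁺ M iB λ J B⊑J iJ →
    p⊑q∧∣q∣≤∣p∣⇒q⊑p B J B⊑J (subst (_ ≤_) (sym ∣B∣≡r) (rank-≥ M iJ))

  extend-within : ∀ {K S B₀} → Independent M K → lookup K ⊑ lookup S → Basis B₀ → lookup B₀ ⊑ lookup S →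
                  ∃ λ B → Basis B × lookup K ⊑ lookup B × lookup B ⊑ lookup S
  extend-within {K} {S} {B₀} iK K⊑S (iB₀ , ∣B₀∣≡r) B₀⊑S =
    grow (rank M ∸ ∣ K ∣) K iK K⊑S (m+[n∸m]≡n (rank-≥ M iK)) (λ _ e → e)
    where
    grow : ∀ d J → Independent M J → lookup J ⊑ lookup S → ∣ J ∣ + d ≡ rank M → lookup K ⊑ lookup J →
           ∃ λ B → Basis B × lookup K ⊑ lookup B × lookup B ⊑ lookup S
    grow zero    J iJ J⊑S ∣J∣+0≡r K⊑J = J , (iJ , trans (sym (+-identityʳ ∣ J ∣)) ∣J∣+0≡r) , K⊑J , J⊑S
    grow (suc d) J iJ J⊑S ∣J∣+d≡r K⊑J
      with augment iJ iB₀ (subst (∣ J ∣ <_) (trans ∣J∣+d≡r (sym ∣B₀∣≡r)) (m<m+n ∣ J ∣ (s≤s z≤n)))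
    ... | x , x∈B₀ , x∉J , iJx =
      grow d (J ∪ ⁅ x ⁆) iJx J∪x⊑S ∣J∪x∣+d≡r (λ i → p⊑p∪⁅x⁆ J x i ∘ K⊑J i)
      where
      J∪x⊑S : lookup (J ∪ ⁅ x ⁆) ⊑ lookup S
      J∪x⊑S i e = [ J⊑S i , (λ { refl → B₀⊑S x x∈B₀ }) ]′ (lookup-∪⁅x⁆⁻ J x i e)
      ∣J∪x∣+d≡r : ∣ J ∪ ⁅ x ⁆ ∣ + d ≡ rank M
      ∣J∪x∣+d≡r = trans (cong (_+ d) (∣p∪⁅x⁆∣ J x x∉J)) (trans (sym (+-suc ∣ J ∣ d)) ∣J∣+d≡r)

  extend : ∀ {K} → Independent M K → ∃ λ B → Basis B × lookup K ⊑ lookup B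
  extend iK with extend-within {S = Subset.⊤} iK (λ i _ → lookup-replicate i true)
                                (proj₂ basis-exists) (λ i _ → lookup-replicate i true)
  ... | B , b , K⊑B , _ = B , b , K⊑B

minor : ∀ {m} → RawMatroid (suc m) → Fin (suc m) → Bool → RawMatroid m
minor M x b = mkRaw (λ I → indep M (insertAt I x b))

module _ {m} (M : RawMatroid (suc m)) (x : Fin (suc m)) where

  ／-nonloop : loop M x ≡ false → M ／ x ≡ minor M x true
  ／-nonloop e rewrite e = refl

  ／-loop : loop M x ≡ true → M ／ x ≡ M ∖ x
  ／-loop e rewrite e = refl

module _ {m} {M : RawMatroid (suc m)} (isM : IsMatroid M) (x : Fin (suc m)) where
  open IsMatroid isM

  minor-isMatroid : ∀ b → Independent M (insertAt Subset.⊥ x b) → IsMatroid (minor M x b)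
  minor-isMatroid b i⊥ = record { I1 = i⊥ ; I2 = I2′ ; I3 = I3′ }
    where
    I2′ : ∀ I J → I Subset.⊆ J → Independent M (insertAt J x b) → Independent M (insertAt I x b)
    I2′ I J I⊆J = independent-⊑ isM (insertAt-⊑ x b (λ i e → []=⇒lookup (I⊆J (lookup⇒[]= i I e))))

    I3′ : ∀ I J → Independent M (insertAt I x b) → Independent M (insertAt J x b) → ∣ I ∣ < ∣ J ∣ →
          ∃ λ y → y Subset.∈ J × y Subset.∉ I × Independent M (insertAt (I ∪ ⁅ y ⁆) x b)
    I3′ I J iI iJ ∣I∣<∣J∣
      with augment isM iI iJ
             (subst₂ _<_ (sym (∣insertAt∣ I x b)) (sym (∣insertAt∣ J x b)) (+-monoʳ-< (indicator b) ∣I∣<∣J∣))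
    ... | z , z∈J , z∉I , iIz with punchIn-view x z
    ...   | inj₁ refl = ⊥-elim (true≢false (begin
            true                        ≡⟨ z∈J ⟨
            lookup (insertAt J x b) x   ≡⟨ insertAt-lookup J x b ⟩
            b                           ≡⟨ insertAt-lookup I x b ⟨
            lookup (insertAt I x b) x   ≡⟨ z∉I ⟩
            false                       ∎))
      where open ≡-Reasoning
    ...   | inj₂ (y , refl) =
            y , lookup⇒[]= y J (trans (sym (insertAt-punchIn J x b y)) z∈J)
              , (λ y∈I → true≢false (trans (sym ([]=⇒lookup y∈I)) (trans (sym (insertAt-punchIn I x b y)) z∉I)))
              , subst (Independent M) (sym (insertAt-∪⁅⁆ I x b y)) iIz

  ∖-isMatroid : IsMatroid (M ∖ x)
  ∖-isMatroid = minor-isMatroid false (subst (Independent M) (sym (insertAt-⊥ x)) I1)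

  ／-isMatroid : IsMatroid (M ／ x)
  ／-isMatroid with loop M x in e
  ... | true  = ∖-isMatroid
  ... | false = minor-isMatroid true (subst (Independent M) (sym (insertAt-⊥-true x)) (nonloop⁻ M x e))

  ∖-independent : ∀ B → Independent M B → Independent (M ∖ x) (removeAt B x)
  ∖-independent B = independent-⊑ isM (insertAt-removeAt-false⊑ B x)

  coloop⇒∈ : coloop M x ≡ true → ∀ {B} → Basis isM B → lookup B x ≡ true
  coloop⇒∈ e b = coloop⁻ M x e (Basis⇒isBasis isM b)

  loop⇒noncoloop : loop M x ≡ true → coloop M x ≡ false
  loop⇒noncoloop e with coloop M x in c
  ... | false = refl
  ... | true with basis-exists isM
  ...   | B , b = ⊥-elim (true≢false (trans (sym x-independent) (not-true⁻ e)))
    where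
    x-independent = independent-⊑ isM (⁅x⁆⊑ {p = B} x (coloop⇒∈ c b)) (proj₁ b)

  rank-∖-noncoloop : coloop M x ≡ false → rank (M ∖ x) ≡ rank M
  rank-∖-noncoloop e with coloop-false⁻ M x e
  ... | B , b , x∉B with isBasis⇒Basis isM b
  ...   | iB , ∣B∣≡r = rank-≡ (M ∖ x) (λ I iI → subst (_≤ rank M) (∣insertAt∣ I x false) (rank-≥ M iI))
            (∖-independent B iB) (trans (sym (∣removeAt∣ B x x∉B)) ∣B∣≡r)

  rank-∖-coloop : coloop M x ≡ true → suc (rank (M ∖ x)) ≡ rank M
  rank-∖-coloop e with basis-exists isM
  ... | B , iB , ∣B∣≡r = trans (cong suc (rank-≡ (M ∖ x) bound (∖-independent B iB) refl)) 1+∣R∣≡r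
    where
    1+∣R∣≡r : suc ∣ removeAt B x ∣ ≡ rank M
    1+∣R∣≡r = trans (sym (∣removeAt∣ B x (coloop⇒∈ e (iB , ∣B∣≡r)))) ∣B∣≡r
    bound : ∀ I → Independent (M ∖ x) I → ∣ I ∣ ≤ ∣ removeAt B x ∣
    bound I iI with m≤n⇒m<n∨m≡n (subst (_≤ rank M) (∣insertAt∣ I x false) (rank-≥ M iI))
    ... | inj₁ ∣I∣<r  = ≤-pred (subst (suc ∣ I ∣ ≤_) (sym 1+∣R∣≡r) ∣I∣<r)
    ... | inj₂ ∣I∣≡r = ⊥-elim (true≢false
            (trans (sym (coloop⇒∈ e (iI , trans (∣insertAt∣ I x false) ∣I∣≡r))) (insertAt-lookup I x false)))

  rank-／-nonloop : loop M x ≡ false → suc (rank (M ／ x)) ≡ rank M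
  rank-／-nonloop e rewrite ／-nonloop M x e with extend isM (nonloop⁻ M x e)
  ... | B , (iB , ∣B∣≡r) , ⁅x⁆⊑B = trans (cong suc (rank-≡ (minor M x true) bound iR refl)) 1+∣R∣≡r
    where
    x∈B = ⁅x⁆⊑B x (lookup-⁅x⁆-x x)
    iR : Independent (minor M x true) (removeAt B x)
    iR = subst (Independent M) (sym (insertAt-removeAt′ B x x∈B)) iB
    1+∣R∣≡r : suc ∣ removeAt B x ∣ ≡ rank M
    1+∣R∣≡r = trans (sym (∣removeAt∣ B x x∈B)) ∣B∣≡r
    bound : ∀ I → Independent (minor M x true) I → ∣ I ∣ ≤ ∣ removeAt B x ∣
    bound I iI = ≤-pred (subst₂ _≤_ (∣insertAt∣ I x true) (sym 1+∣R∣≡r) (rank-≥ M iI))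

  rank-／-loop : loop M x ≡ true → rank (M ／ x) ≡ rank M
  rank-／-loop e rewrite ／-loop M x e = rank-∖-noncoloop (loop⇒noncoloop e)

  ∖-basis⁺ : ∀ B′ → Basis ∖-isMatroid B′ → Basis isM (insertAt B′ x (coloop M x))
  ∖-basis⁺ B′ (iB′ , ∣B′∣≡r′) with coloop M x in c
  ... | false = iB′ , trans (∣insertAt∣ B′ x false) (trans ∣B′∣≡r′ (rank-∖-noncoloop c))
  ... | true with extend isM iB′
  ...   | B , b , B′⊑B = independent-⊑ isM B′+x⊑B (proj₁ b) ,
                         trans (∣insertAt∣ B′ x true) (trans (cong suc ∣B′∣≡r′) (rank-∖-coloop c))
    where
    B′+x⊑B : lookup (insertAt B′ x true) ⊑ lookup B
    B′+x⊑B = punchIn-elim x (λ _ → coloop⇒∈ c b)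
      (λ j e → B′⊑B (punchIn x j) (trans (insertAt-punchIn B′ x false j) (trans (sym (insertAt-punchIn B′ x true j)) e)))

  ∖-basis⁻ : ∀ B → Basis isM B → lookup B x ≡ coloop M x → Basis ∖-isMatroid (removeAt B x)
  ∖-basis⁻ B (iB , ∣B∣≡r) x∈B with coloop M x in c
  ... | false = ∖-independent B iB , trans (sym (∣removeAt∣ B x x∈B)) (trans ∣B∣≡r (sym (rank-∖-noncoloop c)))
  ... | true  = ∖-independent B iB , suc-injective (trans (sym (∣removeAt∣ B x x∈B)) (trans ∣B∣≡r (sym (rank-∖-coloop c))))

module _ {n} {M : RawMatroid n} (isM : IsMatroid M) where

  dual-independent⁻ : ∀ I → Independent (dual M) I → ∃ λ B → Basis isM B × lookup I ⊑ lookup (∁ B)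
  dual-independent⁻ I e with dual⁻ M I e
  ... | B , b , I⊑∁B = B , isBasis⇒Basis isM b , I⊑∁B

  dual-independent⁺ : ∀ I B → Basis isM B → lookup I ⊑ lookup (∁ B) → Independent (dual M) I
  dual-independent⁺ I B b = dual⁺ M I B (Basis⇒isBasis isM b)

  -- Extend BJ − I to a basis B′ inside E − I (possible since BI ⊆ E − I).  Either some z ∈ J − I
  -- misses B′, and then I ∪ {z} misses B′ too, or J − I ⊆ B′ and exchange-count gives ∣J∣ ≤ ∣I∣.
  dual-exchange : ∀ {I J} → Independent (dual M) I → Independent (dual M) J → ∣ I ∣ < ∣ J ∣ →
                  ∃ λ z → z Subset.∈ J × z Subset.∉ I × Independent (dual M) (I ∪ ⁅ z ⁆)
  dual-exchange {I} {J} iI iJ ∣I∣<∣J∣ with dual-independent⁻ I iI | dual-independent⁻ J iJ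
  ... | BI , bI , I⊑∁BI | BJ , bJ , J⊑∁BJ =
    exchange (extend-within isM {K = BJ ∩ ∁ I} {S = ∁ I}
               (independent-⊑ isM BJ∖I⊑BJ (proj₁ bJ)) BJ∖I⊑∁I bI (⊑∁-sym I BI I⊑∁BI))
    where
    BJ∖I : ∀ i → lookup (BJ ∩ ∁ I) i ≡ lookup BJ i ∧ not (lookup I i)
    BJ∖I i = trans (lookup-∩ BJ (∁ I) i) (cong (lookup BJ i ∧_) (lookup-∁ I i))
    BJ∖I⊑BJ : lookup (BJ ∩ ∁ I) ⊑ lookup BJ
    BJ∖I⊑BJ i e = ∧-conicalˡ _ _ (trans (sym (BJ∖I i)) e)
    BJ∖I⊑∁I : lookup (BJ ∩ ∁ I) ⊑ lookup (∁ I)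
    BJ∖I⊑∁I i e = trans (lookup-∁ I i) (∧-conicalʳ _ _ (trans (sym (BJ∖I i)) e))
    J⇒∉BJ : ∀ i → lookup J i ≡ true → lookup BJ i ≡ false
    J⇒∉BJ i i∈J = lookup-∁⁻ BJ (J⊑∁BJ i i∈J)

    exchange : (∃ λ B′ → Basis isM B′ × lookup (BJ ∩ ∁ I) ⊑ lookup B′ × lookup B′ ⊑ lookup (∁ I)) →
               ∃ λ z → z Subset.∈ J × z Subset.∉ I × Independent (dual M) (I ∪ ⁅ z ⁆)
    exchange (B′ , b′ , K⊑B′ , B′⊑∁I)
      with any? (λ z → (lookup J z ≟ᵇ true) ×-dec (lookup I z ≟ᵇ false) ×-dec (lookup B′ z ≟ᵇ false))
    ... | yes (z , z∈J , z∉I , z∉B′) =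
          z , lookup⇒[]= z J z∈J , (λ z∈I → true≢false (trans (sym ([]=⇒lookup z∈I)) z∉I)) ,
          dual-independent⁺ (I ∪ ⁅ z ⁆) B′ b′
            (∪⁅x⁆-⊑ {p = I} {∁ B′} z (⊑∁-sym B′ I B′⊑∁I) (lookup-∁⁺ B′ z∉B′))
    ... | no ∄z = ⊥-elim (<⇒≱ ∣I∣<∣J∣ (subst₂ _≤_ (sym (∣p∣≡count J)) (sym (∣p∣≡count I))
          (exchange-count (lookup I) (lookup J) (lookup BJ) (lookup B′) J⇒∉BJ J∖I⊑B′ BJ∖I⊑B′ ∣B′∣≡∣BJ∣)))
      where
      J∖I⊑B′ : (λ i → lookup J i ∧ not (lookup I i)) ⊑ lookup B′
      J∖I⊑B′ i e with lookup B′ i in i∈B′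
      ... | true  = refl
      ... | false = ⊥-elim (∄z (i , ∧-conicalˡ _ _ e , not-true⁻ (∧-conicalʳ _ _ e) , i∈B′))
      BJ∖I⊑B′ : (λ i → lookup BJ i ∧ not (lookup I i)) ⊑ lookup B′
      BJ∖I⊑B′ i e = K⊑B′ i (trans (BJ∖I i) e)
      ∣B′∣≡∣BJ∣ : count (lookup B′) ≡ count (lookup BJ)
      ∣B′∣≡∣BJ∣ = trans (sym (∣p∣≡count B′)) (trans (proj₂ b′) (trans (sym (proj₂ bJ)) (∣p∣≡count BJ)))

  dual-isMatroid : IsMatroid (dual M)
  dual-isMatroid = record { I1 = I1* ; I2 = I2* ; I3 = λ I J → dual-exchange {I} {J} }
    where
    I1* : Independent (dual M) Subset.⊥
    I1* with basis-exists isM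
    ... | B , b = dual-independent⁺ Subset.⊥ B b (λ i i∈⊥ → ⊥-elim (true≢false (trans (sym i∈⊥) (lookup-⊥ i))))
    I2* : ∀ I J → I Subset.⊆ J → Independent (dual M) J → Independent (dual M) I
    I2* I J I⊆J iJ with dual-independent⁻ J iJ
    ... | B , b , J⊑∁B = dual-independent⁺ I B b (λ i i∈I → J⊑∁B i ([]=⇒lookup (I⊆J (lookup⇒[]= i I i∈I))))

  ∣∁B∣ : ∀ B → Basis isM B → ∣ ∁ B ∣ ≡ n ∸ rank M
  ∣∁B∣ B b = trans (∣∁p∣≡n∸∣p∣ B) (cong (n ∸_) (proj₂ b))

  ∁-basis : ∀ B → Basis isM B → Independent (dual M) (∁ B)
  ∁-basis B b = dual-independent⁺ (∁ B) B b (λ _ e → e)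

  rank-dual : rank (dual M) ≡ n ∸ rank M
  rank-dual with basis-exists isM
  ... | B , b = rank-≡ (dual M) {J = ∁ B} bound (∁-basis B b) (∣∁B∣ B b)
    where
    bound : ∀ I → Independent (dual M) I → ∣ I ∣ ≤ n ∸ rank M
    bound I iI with dual-independent⁻ I iI
    ... | B′ , b′ , I⊑∁B′ = subst (∣ I ∣ ≤_) (∣∁B∣ B′ b′) (∣p∣≤∣q∣ I (∁ B′) I⊑∁B′)

  nullity-dual : nullity (dual M) ≡ rank M
  nullity-dual = trans (cong (n ∸_) rank-dual) (m∸[m∸n]≡n (rank≤n isM))

module _ {n} {M : RawMatroid n} (isM : IsMatroid M) where

  private
    isM* = dual-isMatroid isM

  dual-involutive : ∀ I → indep (dual (dual M)) I ≡ indep M I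
  dual-involutive I = ≡true-ext to from
    where
    to : Independent (dual (dual M)) I → Independent M I
    to e with dual-independent⁻ isM* I e
    ... | B* , (iB* , ∣B*∣≡r*) , I⊑∁B* with dual-independent⁻ isM B* iB*
    ...   | B , b , B*⊑∁B = independent-⊑ isM I⊑B (proj₁ b)
      where
      ∁B⊑B* : lookup (∁ B) ⊑ lookup B*
      ∁B⊑B* = p⊑q∧∣q∣≤∣p∣⇒q⊑p B* (∁ B) B*⊑∁B
                (≤-reflexive (trans (∣∁B∣ isM B b) (trans (sym (rank-dual isM)) (sym ∣B*∣≡r*))))
      I⊑B : lookup I ⊑ lookup B
      I⊑B i i∈I with lookup B i in i∈B
      ... | true  = refl
      ... | false = ⊥-elim (true≢false (trans (sym (∁B⊑B* i (lookup-∁⁺ B i∈B))) (lookup-∁⁻ B* (I⊑∁B* i i∈I))))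
    from : Independent M I → Independent (dual (dual M)) I
    from iI with extend isM iI
    ... | B , b , I⊑B = dual-independent⁺ isM* I (∁ B) (∁-basis isM B b , trans (∣∁B∣ isM B b) (sym (rank-dual isM)))
                          (λ i i∈I → lookup-∁⁺ (∁ B) (trans (lookup-∁ B i) (cong not (I⊑B i i∈I))))

module _ {m} {M : RawMatroid (suc m)} (isM : IsMatroid M) (x : Fin (suc m)) where

  coloop≡loop-dual : coloop M x ≡ loop (dual M) x
  coloop≡loop-dual with coloop M x in c | indep (dual M) ⁅ x ⁆ in d
  ... | true  | false = refl
  ... | false | true  = refl
  ... | true  | true with dual-independent⁻ isM ⁅ x ⁆ d
  ...   | B , b , x⊑∁B =
    ⊥-elim (true≢false (trans (sym (coloop⇒∈ isM x c b)) (lookup-∁⁻ B (x⊑∁B x (lookup-⁅x⁆-x x)))))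
  coloop≡loop-dual | false | false with coloop-false⁻ M x c
  ... | B , b , x∉B = ⊥-elim (true≢false (trans (sym (dual⁺ M ⁅ x ⁆ B b (⁅x⁆⊑ {p = ∁ B} x (lookup-∁⁺ B x∉B)))) d))

  indep-dual-∖ : ∀ I → indep (dual (M ∖ x)) I ≡ indep (dual M) (insertAt I x (not (coloop M x)))
  indep-dual-∖ I = ≡true-ext to from
    where
    c = coloop M x
    to : Independent (dual (M ∖ x)) I → Independent (dual M) (insertAt I x (not c))
    to e with dual-independent⁻ (∖-isMatroid isM x) I e
    ... | B′ , b′ , I⊑∁B′ = dual-independent⁺ isM (insertAt I x (not c)) (insertAt B′ x c) (∖-basis⁺ isM x B′ b′)
            (subst (λ S → lookup (insertAt I x (not c)) ⊑ lookup S) (sym (∁-insertAt B′ x c)) (insertAt-⊑ x (not c) I⊑∁B′))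
    from : Independent (dual M) (insertAt I x (not c)) → Independent (dual (M ∖ x)) I
    from e with dual-independent⁻ isM (insertAt I x (not c)) e
    ... | B , b , I+x⊑∁B = dual-independent⁺ (∖-isMatroid isM x) I (removeAt B x) (∖-basis⁻ isM x B b x∈B)
            (insertAt-⊑⁻ x (not c) (not c) (subst (λ S → lookup (insertAt I x (not c)) ⊑ lookup S)
              (trans (cong ∁ (sym (insertAt-removeAt′ B x x∈B))) (∁-insertAt (removeAt B x) x c)) I+x⊑∁B))
      where
      x∈B : lookup B x ≡ c
      x∈B = by-cases c refl
        where
        by-cases : ∀ c′ → c ≡ c′ → lookup B x ≡ c
        by-cases true  c≡ = trans (coloop⇒∈ isM x c≡ b) (sym c≡)
        by-cases false c≡ = trans (lookup-∁⁻ B (I+x⊑∁B x (trans (insertAt-lookup I x (not c)) (cong not c≡)))) (sym c≡)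

  indep-dual-／ : ∀ I → indep (dual M ／ x) I ≡ indep (dual M) (insertAt I x (not (coloop M x)))
  indep-dual-／ I rewrite coloop≡loop-dual with loop (dual M) x
  ... | true  = refl
  ... | false = refl

countL : ∀ {A : Set} → (A → Bool) → List A → ℕ
countL p xs = length (filter (T? ∘ p) xs)

module _ {A : Set} (p : A → Bool) where

  countL-∷ : ∀ x xs → countL p (x ∷ xs) ≡ indicator (p x) + countL p xs
  countL-∷ x xs with p x
  ... | true  = refl
  ... | false = refl

  countL-++ : ∀ xs ys → countL p (xs ++ ys) ≡ countL p xs + countL p ys
  countL-++ xs ys = trans (cong length (filter-++ (T? ∘ p) xs ys)) (length-++ (filter (T? ∘ p) xs))

  countL-map : ∀ {B : Set} (f : B → A) xs → countL p (map f xs) ≡ countL (p ∘ f) xs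
  countL-map f []       = refl
  countL-map f (x ∷ xs) with p (f x)
  ... | true  = cong suc (countL-map f xs)
  ... | false = countL-map f xs

  countL-filter : ∀ (q : A → Bool) xs → countL p (filter (T? ∘ q) xs) ≡ countL (λ a → q a ∧ p a) xs
  countL-filter q []       = refl
  countL-filter q (x ∷ xs) with q x
  ... | false = countL-filter q xs
  ... | true with p x
  ...   | true  = cong suc (countL-filter q xs)
  ...   | false = countL-filter q xs

  countL-concatMap : ∀ {B : Set} (g : B → List A) xs → countL p (concatMap g xs) ≡ sumˡ (map (countL p ∘ g) xs)
  countL-concatMap g []       = refl
  countL-concatMap g (x ∷ xs) = trans (countL-++ (g x) (concatMap g xs)) (cong (countL p (g x) +_) (countL-concatMap g xs))

allFinL-suc : ∀ n → allFinL (suc n) ≡ zero ∷ map suc (allFinL n)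
allFinL-suc n = cong (zero ∷_) (trans (cong toList (tabulate-∘ suc id)) (toList-map suc (tabulate id)))

module _ {c ℓ} (M : CommutativeMonoid c ℓ) where
  open CommutativeMonoid M using (Carrier; _∙_; ε)
  open import Algebra.Properties.CommutativeMonoid.Sum M using () renaming (sum to ∑)

  foldr-allFinL : ∀ n (g : Fin n → Carrier) → foldr _∙_ ε (map g (allFinL n)) ≡ ∑ g
  foldr-allFinL zero    g = refl
  foldr-allFinL (suc n) g = trans (cong (foldr _∙_ ε ∘ map g) (allFinL-suc n))
    (cong (g zero ∙_) (trans (cong (foldr _∙_ ε) (sym (map-∘ (allFinL n)))) (foldr-allFinL n (g ∘ suc))))

countL-allFinL : ∀ n (p : Fin n → Bool) → countL p (allFinL n) ≡ count p
countL-allFinL zero    p = refl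
countL-allFinL (suc n) p = begin
  countL p (allFinL (suc n))                           ≡⟨ cong (countL p) (allFinL-suc n) ⟩
  countL p (zero ∷ map suc (allFinL n))                ≡⟨ countL-∷ p zero (map suc (allFinL n)) ⟩
  indicator (p zero) + countL p (map suc (allFinL n))  ≡⟨ cong (indicator (p zero) +_) (countL-map p suc (allFinL n)) ⟩
  indicator (p zero) + countL (p ∘ suc) (allFinL n)    ≡⟨ cong (indicator (p zero) +_) (countL-allFinL n (p ∘ suc)) ⟩
  count p                                              ∎
  where open ≡-Reasoning

_<ᶠ_ : ∀ {n} → Fin n → Fin n → Bool
i <ᶠ j = toℕ i <ᵇ toℕ j

inversionCount : ∀ {n} → (Fin n → Fin n) → ℕ
inversionCount f = sum λ i → count λ j → (i <ᶠ j) ∧ (f j <ᶠ f i)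

inversions≡inversionCount : ∀ {n} (ψ : Permutation′ n) → inversions ψ ≡ inversionCount (ψ ⟨$⟩ʳ_)
inversions≡inversionCount {n} ψ = begin
  countL P (concatMap pairs (allFinL n))           ≡⟨ countL-concatMap P pairs (allFinL n) ⟩
  sumˡ (map (countL P ∘ pairs) (allFinL n))        ≡⟨ foldr-allFinL +-0-commutativeMonoid n (countL P ∘ pairs) ⟩
  sum (countL P ∘ pairs)                           ≡⟨ sum-cong-≗ row ⟩
  inversionCount f                                 ∎
  where
  open ≡-Reasoning
  f = ψ ⟨$⟩ʳ_
  P : Fin n × Fin n → Bool
  P ij = f (proj₂ ij) <ᶠ f (proj₁ ij)
  pairs : Fin n → List (Fin n × Fin n)
  pairs i = map (i ,_) (filter (T? ∘ (i <ᶠ_)) (allFinL n))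
  row : ∀ i → countL P (pairs i) ≡ count (λ j → (i <ᶠ j) ∧ (f j <ᶠ f i))
  row i = trans (countL-map P (i ,_) (filter (T? ∘ (i <ᶠ_)) (allFinL n))) (trans (countL-filter (P ∘ (i ,_)) (i <ᶠ_) (allFinL n))
                (countL-allFinL n (λ j → (i <ᶠ j) ∧ (f j <ᶠ f i))))

<ᵇ-irrefl : ∀ a → (a <ᵇ a) ≡ false
<ᵇ-irrefl zero    = refl
<ᵇ-irrefl (suc a) = <ᵇ-irrefl a

<ᵇ-asym : ∀ a b → (a <ᵇ b) ∧ (b <ᵇ a) ≡ false
<ᵇ-asym zero    zero    = refl
<ᵇ-asym zero    (suc b) = refl
<ᵇ-asym (suc a) zero    = refl
<ᵇ-asym (suc a) (suc b) = <ᵇ-asym a b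

<ᵇ-connex : ∀ a b → a ≢ b → indicator (a <ᵇ b) + indicator (b <ᵇ a) ≡ 1
<ᵇ-connex zero    zero    a≢b = ⊥-elim (a≢b refl)
<ᵇ-connex zero    (suc b) _   = refl
<ᵇ-connex (suc a) zero    _   = refl
<ᵇ-connex (suc a) (suc b) a≢b = <ᵇ-connex a b (a≢b ∘ cong suc)

punchIn-<ᶠ : ∀ {m} (c : Fin (suc m)) (u v : Fin m) → punchIn c u <ᶠ punchIn c v ≡ u <ᶠ v
punchIn-<ᶠ zero    u       v       = refl
punchIn-<ᶠ (suc c) zero    zero    = refl
punchIn-<ᶠ (suc c) zero    (suc v) = refl
punchIn-<ᶠ (suc c) (suc u) zero    = refl
punchIn-<ᶠ (suc c) (suc u) (suc v) = punchIn-<ᶠ c u v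

count-<ᶠ : ∀ {n} (c : Fin n) → count (_<ᶠ c) ≡ toℕ c
count-<ᶠ {suc n} zero    = sum-replicate-zero n
count-<ᶠ {suc n} (suc c) = cong suc (count-<ᶠ c)

indicator-partition : ∀ a b p → indicator a + indicator b ≡ 1 → indicator (a ∧ p) + indicator (b ∧ p) ≡ indicator p
indicator-partition true  false p _ = +-identityʳ (indicator p)
indicator-partition false true  p _ = refl
indicator-partition true  true  p ()
indicator-partition false false p ()

parity-+ : ∀ a b → parity (a + b) ≡ parity a *ˢ parity b
parity-+ zero    b = refl
parity-+ (suc a) b = trans (cong Sign.opposite (parity-+ a b)) (opposite-* (parity a) (parity b))
  where
  opposite-* : ∀ s t → Sign.opposite (s *ˢ t) ≡ Sign.opposite s *ˢ t
  opposite-* Sign.+ t      = refl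
  opposite-* Sign.- Sign.+ = refl
  opposite-* Sign.- Sign.- = refl

parity-double : ∀ c → parity (c + c) ≡ Sign.+
parity-double c = trans (parity-+ c c) (s*s≡+ (parity c))

module _ {m} (ψ : Permutation′ (suc m)) (x : Fin (suc m)) where

  private
    f = ψ ⟨$⟩ʳ_
    f′ = remove x ψ ⟨$⟩ʳ_

    f-injective : ∀ {i j} → f i ≡ f j → i ≡ j
    f-injective e = trans (sym (inverseˡ ψ)) (trans (cong (ψ ⟨$⟩ˡ_) e) (inverseˡ ψ))

    inverted : Fin (suc m) → Fin (suc m) → ℕ
    inverted i j = indicator ((i <ᶠ j) ∧ (f j <ᶠ f i))

    -- The inversions of f involving x are after (pairs (x , j)) plus before (pairs (i , x)).  With
    -- below = #{j < x ∣ f j < f x} one has after + below = f x and before + below = x, so their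
    -- number has the parity of x + f x; the remaining inversions are those of remove x ψ.

    after before below : ℕ
    after  = sum (inverted x)
    before = sum (λ a → inverted (punchIn x a) x)
    below  = count (λ j → (j <ᶠ x) ∧ (f j <ᶠ f x))

  inversionCount-remove : inversionCount f ≡ after + (before + inversionCount f′)
  inversionCount-remove = begin
    sum (λ i → sum (inverted i))
      ≡⟨ sum-remove {i = x} (λ i → sum (inverted i)) ⟩
    after + sum (λ a → sum (inverted (punchIn x a)))
      ≡⟨ cong (after +_) (sum-cong-≗ (λ a → sum-remove {i = x} (inverted (punchIn x a)))) ⟩
    after + sum (λ a → inverted (punchIn x a) x + sum (inverted (punchIn x a) ∘ punchIn x))
      ≡⟨ cong (after +_) (∑-distrib-+ (λ a → inverted (punchIn x a) x) (λ a → sum (inverted (punchIn x a) ∘ punchIn x))) ⟩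
    after + (before + sum (λ a → sum (inverted (punchIn x a) ∘ punchIn x)))
      ≡⟨ cong (λ s → after + (before + s)) (sum-cong-≗ (λ a → count-cong (punchIn-inverted a))) ⟩
    after + (before + inversionCount f′)
      ∎
    where
    open ≡-Reasoning
    punchIn-inverted : ∀ a b → (punchIn x a <ᶠ punchIn x b) ∧ (f (punchIn x b) <ᶠ f (punchIn x a)) ≡
                               (a <ᶠ b) ∧ (f′ b <ᶠ f′ a)
    punchIn-inverted a b = cong₂ _∧_ (punchIn-<ᶠ x a b) (begin
      f (punchIn x b) <ᶠ f (punchIn x a)                       ≡⟨ cong₂ _<ᶠ_ (punchIn-permute ψ x b) (punchIn-permute ψ x a) ⟩
      punchIn (f x) (f′ b) <ᶠ punchIn (f x) (f′ a)             ≡⟨ punchIn-<ᶠ (f x) (f′ b) (f′ a) ⟩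
      f′ b <ᶠ f′ a                                             ∎)

  after+below : after + below ≡ toℕ (f x)
  after+below = begin
    after + below                           ≡⟨ ∑-distrib-+ (inverted x) (λ j → indicator ((j <ᶠ x) ∧ (f j <ᶠ f x))) ⟨
    sum (λ j → inverted x j + indicator ((j <ᶠ x) ∧ (f j <ᶠ f x)))   ≡⟨ sum-cong-≗ split ⟩
    count (λ j → f j <ᶠ f x)                ≡⟨ sum-permute (λ v → indicator (v <ᶠ f x)) ψ ⟨
    count (_<ᶠ f x)                         ≡⟨ count-<ᶠ (f x) ⟩
    toℕ (f x)                               ∎
    where
    open ≡-Reasoning
    split : ∀ j → inverted x j + indicator ((j <ᶠ x) ∧ (f j <ᶠ f x)) ≡ indicator (f j <ᶠ f x)
    split j with j ≟ x
    ... | yes refl rewrite <ᵇ-irrefl (toℕ j) | <ᵇ-irrefl (toℕ (f j)) = refl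
    ... | no j≢x = indicator-partition (x <ᶠ j) (j <ᶠ x) (f j <ᶠ f x)
                     (<ᵇ-connex (toℕ x) (toℕ j) (j≢x ∘ sym ∘ toℕ-injective))

  before+below : before + below ≡ toℕ x
  before+below = begin
    before + below                          ≡⟨ cong (_+ below) before≡ ⟩
    count (λ j → (j <ᶠ x) ∧ (f x <ᶠ f j)) + below
      ≡⟨ ∑-distrib-+ (λ j → indicator ((j <ᶠ x) ∧ (f x <ᶠ f j))) (λ j → indicator ((j <ᶠ x) ∧ (f j <ᶠ f x))) ⟨
    sum (λ j → indicator ((j <ᶠ x) ∧ (f x <ᶠ f j)) + indicator ((j <ᶠ x) ∧ (f j <ᶠ f x)))   ≡⟨ sum-cong-≗ split ⟩
    count (_<ᶠ x)                           ≡⟨ count-<ᶠ x ⟩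
    toℕ x                                   ∎
    where
    open ≡-Reasoning
    before≡ : before ≡ count (λ j → (j <ᶠ x) ∧ (f x <ᶠ f j))
    before≡ = sym (trans (sum-remove {i = x} (λ j → indicator ((j <ᶠ x) ∧ (f x <ᶠ f j))))
                         (cong (λ b → indicator (b ∧ (f x <ᶠ f x)) + before) (<ᵇ-irrefl (toℕ x))))
    split : ∀ j → indicator ((j <ᶠ x) ∧ (f x <ᶠ f j)) + indicator ((j <ᶠ x) ∧ (f j <ᶠ f x)) ≡ indicator (j <ᶠ x)
    split j with j ≟ x
    ... | yes refl rewrite <ᵇ-irrefl (toℕ j) = refl
    ... | no j≢x rewrite ∧-comm (j <ᶠ x) (f x <ᶠ f j) | ∧-comm (j <ᶠ x) (f j <ᶠ f x) =
      indicator-partition (f x <ᶠ f j) (f j <ᶠ f x) (j <ᶠ x)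
        (<ᵇ-connex (toℕ (f x)) (toℕ (f j)) (j≢x ∘ f-injective ∘ toℕ-injective ∘ sym))

  sgn-remove : sgn ψ ≡ sgn (remove x ψ) *ˢ parity (toℕ x + toℕ (f x))
  sgn-remove = begin
    parity (inversions ψ)
      ≡⟨ cong parity (trans (inversions≡inversionCount ψ) inversionCount-remove) ⟩
    parity (after + (before + inversionCount f′))             ≡⟨ cong parity (rotate after before (inversionCount f′)) ⟩
    parity (inversionCount f′ + (after + before))             ≡⟨ parity-+ (inversionCount f′) (after + before) ⟩
    parity (inversionCount f′) *ˢ parity (after + before)
      ≡⟨ cong₂ (λ k s → parity k *ˢ s) (sym (inversions≡inversionCount (remove x ψ))) parity-after+before ⟩
    sgn (remove x ψ) *ˢ parity (toℕ x + toℕ (f x))             ∎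
    where
    open ≡-Reasoning
    rotate : ∀ a b c → a + (b + c) ≡ c + (a + b)
    rotate = solve-∀
    regroup : ∀ a b c → (a + b) + (c + c) ≡ (b + c) + (a + c)
    regroup = solve-∀
    parity-after+before : parity (after + before) ≡ parity (toℕ x + toℕ (f x))
    parity-after+before = begin
      parity (after + before)                               ≡⟨ *-identityʳ _ ⟨
      parity (after + before) *ˢ Sign.+                     ≡⟨ cong (parity (after + before) *ˢ_) (parity-double below) ⟨
      parity (after + before) *ˢ parity (below + below)     ≡⟨ parity-+ (after + before) (below + below) ⟨
      parity ((after + before) + (below + below))           ≡⟨ cong parity (regroup after before below) ⟩
      parity ((before + below) + (after + below))           ≡⟨ cong₂ (λ a b → parity (a + b)) before+below after+below ⟩
      parity (toℕ x + toℕ (f x))                            ∎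

  ιsign-remove : ∀ s → sgn (remove x ψ) *ˢ ιsign x s ≡ ιsign (f x) (sgn ψ *ˢ s)
  ιsign-remove s = sym (begin
    c *ˢ (sgn ψ *ˢ s)
      ≡⟨ cong (λ t → c *ˢ (t *ˢ s)) (trans sgn-remove (cong (a *ˢ_) (parity-+ (toℕ x) (toℕ (f x))))) ⟩
    c *ˢ ((a *ˢ (b *ˢ c)) *ˢ s)
      ≡⟨ solve 4 (λ a b c s → c ⊕ ((a ⊕ (b ⊕ c)) ⊕ s) ⊜ (a ⊕ (b ⊕ s)) ⊕ (c ⊕ c)) refl a b c s ⟩
    (a *ˢ (b *ˢ s)) *ˢ (c *ˢ c)         ≡⟨ cong ((a *ˢ (b *ˢ s)) *ˢ_) (s*s≡+ c) ⟩
    (a *ˢ (b *ˢ s)) *ˢ Sign.+           ≡⟨ *-identityʳ (a *ˢ (b *ˢ s)) ⟩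
    a *ˢ (b *ˢ s)                       ∎)
    where
    open ≡-Reasoning
    a = sgn (remove x ψ)
    b = parity (toℕ x)
    c = parity (toℕ (f x))

sgn-id : ∀ {n} → sgn (Permutation.id {n}) ≡ Sign.+
sgn-id {n} = cong parity (begin
  inversions (Permutation.id {n})                           ≡⟨ inversions≡inversionCount (Permutation.id {n}) ⟩
  sum {n} (λ i → count (λ j → (i <ᶠ j) ∧ (j <ᶠ i)))
    ≡⟨ sum-cong-≗ {n} (λ i → count-cong {n} (λ j → <ᵇ-asym (toℕ i) (toℕ j))) ⟩
  sum {n} (λ i → count {n} (λ _ → false))                   ≡⟨ sum-cong-≗ {n} (λ _ → sum-replicate-zero n) ⟩
  sum {n} (λ _ → 0)                                         ≡⟨ sum-replicate-zero n ⟩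
  0                                                         ∎)
  where open ≡-Reasoning

ιsign-opposite : ∀ {m} (x : Fin (suc m)) s → ιsign x (Sign.opposite s) ≡ Sign.opposite (ιsign x s)
ιsign-opposite x s with parity (toℕ x)
... | Sign.+ = refl
... | Sign.- = refl

module _ {n} (ψ : Permutation′ n) where

  lookup-image : ∀ I y → lookup (image ψ I) y ≡ lookup I (ψ ⟨$⟩ˡ y)
  lookup-image I y = lookup∘tabulate _ y

  lookup-image-ψ : ∀ I i → lookup (image ψ I) (ψ ⟨$⟩ʳ i) ≡ lookup I i
  lookup-image-ψ I i = trans (lookup-image I (ψ ⟨$⟩ʳ i)) (cong (lookup I) (inverseˡ ψ))

  image-surjective : ∀ J → ∃ λ I → image ψ I ≡ J
  image-surjective J = tabulate J∘ψ , lookup-ext λ y →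
    trans (lookup-image (tabulate J∘ψ) y) (trans (lookup∘tabulate J∘ψ (ψ ⟨$⟩ˡ y)) (cong (lookup J) (inverseʳ ψ)))
    where
    J∘ψ = λ i → lookup J (ψ ⟨$⟩ʳ i)

  image-⊑ : ∀ I J → lookup I ⊑ lookup J → lookup (image ψ I) ⊑ lookup (image ψ J)
  image-⊑ I J I⊑J y e = trans (lookup-image J y) (I⊑J (ψ ⟨$⟩ˡ y) (trans (sym (lookup-image I y)) e))

  image-⊑⁻ : ∀ I J → lookup (image ψ I) ⊑ lookup (image ψ J) → lookup I ⊑ lookup J
  image-⊑⁻ I J ψI⊑ψJ i e = trans (sym (lookup-image-ψ J i)) (ψI⊑ψJ (ψ ⟨$⟩ʳ i) (trans (lookup-image-ψ I i) e))

  image-∁ : ∀ I → image ψ (∁ I) ≡ ∁ (image ψ I)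
  image-∁ I = lookup-ext λ y → trans (lookup-image (∁ I) y)
    (trans (lookup-∁ I (ψ ⟨$⟩ˡ y)) (sym (trans (lookup-∁ (image ψ I) y) (cong not (lookup-image I y)))))

  image-⁅⁆ : ∀ x → image ψ ⁅ x ⁆ ≡ ⁅ ψ ⟨$⟩ʳ x ⁆
  image-⁅⁆ x = lookup-ext λ y → trans (lookup-image ⁅ x ⁆ y) (≡true-ext
    (λ e → subst (λ z → lookup ⁅ ψ ⟨$⟩ʳ x ⁆ z ≡ true)
             (trans (cong (ψ ⟨$⟩ʳ_) (sym (lookup-⁅x⁆⁻ x _ e))) (inverseʳ ψ)) (lookup-⁅x⁆-x (ψ ⟨$⟩ʳ x)))
    (λ e → subst (λ z → lookup ⁅ x ⁆ z ≡ true)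
             (sym (trans (cong (ψ ⟨$⟩ˡ_) (lookup-⁅x⁆⁻ (ψ ⟨$⟩ʳ x) y e)) (inverseˡ ψ))) (lookup-⁅x⁆-x x)))

module _ {m} (ψ : Permutation′ (suc m)) (x : Fin (suc m)) where

  private
    ψ′ = remove x ψ

  ψˡ-punchIn : ∀ j → ψ ⟨$⟩ˡ punchIn (ψ ⟨$⟩ʳ x) j ≡ punchIn x (ψ′ ⟨$⟩ˡ j)
  ψˡ-punchIn j = trans (cong (ψ ⟨$⟩ˡ_) (sym ψ-punchIn)) (inverseˡ ψ)
    where
    ψ-punchIn : ψ ⟨$⟩ʳ punchIn x (ψ′ ⟨$⟩ˡ j) ≡ punchIn (ψ ⟨$⟩ʳ x) j
    ψ-punchIn = trans (punchIn-permute ψ x (ψ′ ⟨$⟩ˡ j)) (cong (punchIn (ψ ⟨$⟩ʳ x)) (inverseʳ ψ′))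

  image-insertAt : ∀ I b → image ψ (insertAt I x b) ≡ insertAt (image ψ′ I) (ψ ⟨$⟩ʳ x) b
  image-insertAt I b = lookup-ext (punchIn-elim (ψ ⟨$⟩ʳ x)
    (trans (lookup-image-ψ ψ (insertAt I x b) x)
           (trans (insertAt-lookup I x b) (sym (insertAt-lookup (image ψ′ I) (ψ ⟨$⟩ʳ x) b))))
    (λ j → begin
      lookup (image ψ (insertAt I x b)) (punchIn (ψ ⟨$⟩ʳ x) j)    ≡⟨ lookup-image ψ (insertAt I x b) _ ⟩
      lookup (insertAt I x b) (ψ ⟨$⟩ˡ punchIn (ψ ⟨$⟩ʳ x) j)       ≡⟨ cong (lookup (insertAt I x b)) (ψˡ-punchIn j) ⟩
      lookup (insertAt I x b) (punchIn x (ψ′ ⟨$⟩ˡ j))             ≡⟨ insertAt-punchIn I x b _ ⟩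
      lookup I (ψ′ ⟨$⟩ˡ j)                                        ≡⟨ lookup-image ψ′ I j ⟨
      lookup (image ψ′ I) j                                       ≡⟨ insertAt-punchIn (image ψ′ I) (ψ ⟨$⟩ʳ x) b j ⟨
      lookup (insertAt (image ψ′ I) (ψ ⟨$⟩ʳ x) b) (punchIn (ψ ⟨$⟩ʳ x) j) ∎))
    where open ≡-Reasoning

module _ {n} (ψ : Permutation′ n) {M M′ : RawMatroid n} (iso : IsIso ψ M M′) where

  isBasis-image : ∀ B → isBasis M′ (image ψ B) ≡ isBasis M B
  isBasis-image B = ≡true-ext to from
    where
    to : isBasis M′ (image ψ B) ≡ true → isBasis M B ≡ true
    to b′ with isBasis⁻ M′ b′
    ... | iψB , maxψB = isBasis⁺ M (trans (sym (iso B)) iψB) λ J B⊑J iJ →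
      image-⊑⁻ ψ J B (maxψB (image ψ J) (image-⊑ ψ B J B⊑J) (trans (iso J) iJ))
    from : isBasis M B ≡ true → isBasis M′ (image ψ B) ≡ true
    from b with isBasis⁻ M b
    ... | iB , maxB = isBasis⁺ M′ (trans (iso B) iB) maximal
      where
      maximal : Maximal M′ (image ψ B)
      maximal J′ with image-surjective ψ J′
      ... | J , refl = λ ψB⊑ψJ iψJ → image-⊑ ψ J B (maxB J (image-⊑⁻ ψ B J ψB⊑ψJ) (trans (sym (iso J)) iψJ))

  dual-iso : IsIso ψ (dual M) (dual M′)
  dual-iso I = ≡true-ext to from
    where
    to : Independent (dual M′) (image ψ I) → Independent (dual M) I
    to e with dual⁻ M′ (image ψ I) e
    ... | B′ , b′ , ψI⊑∁B′ with image-surjective ψ B′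
    ...   | B , refl = dual⁺ M I B (trans (sym (isBasis-image B)) b′)
                         (image-⊑⁻ ψ I (∁ B) (subst (λ S → lookup (image ψ I) ⊑ lookup S) (sym (image-∁ ψ B)) ψI⊑∁B′))
    from : Independent (dual M) I → Independent (dual M′) (image ψ I)
    from e with dual⁻ M I e
    ... | B , b , I⊑∁B = dual⁺ M′ (image ψ I) (image ψ B) (trans (isBasis-image B) b)
                           (subst (λ S → lookup (image ψ I) ⊑ lookup S) (image-∁ ψ B) (image-⊑ ψ I (∁ B) I⊑∁B))

module _ {m} (ψ : Permutation′ (suc m)) {M M′ : RawMatroid (suc m)} (iso : IsIso ψ M M′) (x : Fin (suc m)) where

  private
    ψ′ = remove x ψ

  coloop-iso : coloop M′ (ψ ⟨$⟩ʳ x) ≡ coloop M x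
  coloop-iso = ≡true-ext to from
    where
    to : coloop M′ (ψ ⟨$⟩ʳ x) ≡ true → coloop M x ≡ true
    to e = coloop⁺ M x λ {B} b →
      trans (sym (lookup-image-ψ ψ B x)) (coloop⁻ M′ (ψ ⟨$⟩ʳ x) e (trans (isBasis-image ψ iso B) b))
    from : coloop M x ≡ true → coloop M′ (ψ ⟨$⟩ʳ x) ≡ true
    from e = coloop⁺ M′ (ψ ⟨$⟩ʳ x) in-every-basis
      where
      in-every-basis : ∀ {B′} → isBasis M′ B′ ≡ true → lookup B′ (ψ ⟨$⟩ʳ x) ≡ true
      in-every-basis {B′} b′ with image-surjective ψ B′
      ... | B , refl = trans (lookup-image-ψ ψ B x) (coloop⁻ M x e (trans (sym (isBasis-image ψ iso B)) b′))

  loop-iso : loop M′ (ψ ⟨$⟩ʳ x) ≡ loop M x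
  loop-iso = cong not (trans (cong (indep M′) (sym (image-⁅⁆ ψ x))) (iso ⁅ x ⁆))

  minor-iso : ∀ b → IsIso ψ′ (minor M x b) (minor M′ (ψ ⟨$⟩ʳ x) b)
  minor-iso b I = trans (cong (indep M′) (sym (image-insertAt ψ x I b))) (iso (insertAt I x b))

  ／-iso : IsIso ψ′ (M ／ x) (M′ ／ (ψ ⟨$⟩ʳ x))
  ／-iso = by-cases (loop M x) refl
    where
    by-cases : ∀ l → loop M x ≡ l → IsIso ψ′ (M ／ x) (M′ ／ (ψ ⟨$⟩ʳ x))
    by-cases true  l = subst₂ (IsIso ψ′) (sym (／-loop M x l)) (sym (／-loop M′ (ψ ⟨$⟩ʳ x) (trans loop-iso l)))
                              (minor-iso false)
    by-cases false l = subst₂ (IsIso ψ′) (sym (／-nonloop M x l)) (sym (／-nonloop M′ (ψ ⟨$⟩ʳ x) (trans loop-iso l)))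
                              (minor-iso true)

+ᵗ-commutativeMonoid : CommutativeMonoid 0ℓ 0ℓ
+ᵗ-commutativeMonoid = record
  { Carrier             = Term
  ; _≈_                 = _≈_
  ; _∙_                 = _+ᵗ_
  ; ε                   = 0ᵗ
  ; isCommutativeMonoid = record
    { isMonoid = record
      { isSemigroup = record
        { isMagma = record
          { isEquivalence = record { refl = refl′ ; sym = sym′ ; trans = trans′ }
          ; ∙-cong        = +-cong
          }
        ; assoc = λ _ _ _ → +-assoc
        }
      ; identity = (λ _ → trans′ +-comm +-idʳ) , (λ _ → +-idʳ)
      }
    ; comm = λ _ _ → +-comm
    }
  }

open import Algebra.Properties.CommutativeMonoid.Sum +ᵗ-commutativeMonoid
  using () renaming (sum to ∑ᵗ; sum-cong-≋ to ∑ᵗ-cong; sum-permute to ∑ᵗ-permute)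
module ≈-Reasoning = Relation.Binary.Reasoning.Setoid (CommutativeMonoid.setoid +ᵗ-commutativeMonoid)

≡⇒≈ : ∀ {t u} → t ≡ u → t ≈ u
≡⇒≈ refl = refl′

•-zeroʳ : ∀ {q} → q • 0ᵗ ≈ 0ᵗ
•-zeroʳ {q} = begin
  q • 0ᵗ                                           ≈⟨ +-idʳ ⟨
  q • 0ᵗ +ᵗ 0ᵗ                                     ≈⟨ +-cong refl′ +-invʳ ⟨
  q • 0ᵗ +ᵗ (q • 0ᵗ +ᵗ (- 1ℚ) • (q • 0ᵗ))           ≈⟨ +-assoc ⟨
  (q • 0ᵗ +ᵗ q • 0ᵗ) +ᵗ (- 1ℚ) • (q • 0ᵗ)           ≈⟨ +-cong (trans′ (sym′ •-distˡ) (•-cong +-idʳ)) refl′ ⟩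
  q • 0ᵗ +ᵗ (- 1ℚ) • (q • 0ᵗ)                      ≈⟨ +-invʳ ⟩
  0ᵗ                                               ∎
  where open ≈-Reasoning

•-∑ᵗ : ∀ {n} q (f : Fin n → Term) → q • ∑ᵗ f ≈ ∑ᵗ (λ i → q • f i)
•-∑ᵗ {zero}  q f = •-zeroʳ
•-∑ᵗ {suc n} q f = trans′ •-distˡ (+-cong refl′ (•-∑ᵗ q (f ∘ suc)))

dualMap-∑ᵗ : ∀ {n} (f : Fin n → Term) → dualMap (∑ᵗ f) ≡ ∑ᵗ (dualMap ∘ f)
dualMap-∑ᵗ {zero}  f = refl
dualMap-∑ᵗ {suc n} f = cong (dualMap (f zero) +ᵗ_) (dualMap-∑ᵗ (f ∘ suc))

if-≈ : ∀ {b b′ t t′} → b ≡ b′ → (b ≡ true → t ≈ t′) → (if b then t else 0ᵗ) ≈ (if b′ then t′ else 0ᵗ)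
if-≈ {true}  refl t≈t′ = t≈t′ refl
if-≈ {false} refl _    = refl′

if-• : ∀ b q {t t′} → t′ ≈ q • t → (if b then t′ else 0ᵗ) ≈ q • (if b then t else 0ᵗ)
if-• true  q t′≈qt = t′≈qt
if-• false q _     = sym′ •-zeroʳ

Selector : Set
Selector = ∀ {m} → RawMatroid (suc m) → Fin (suc m) → Bool

Minor : Set
Minor = ∀ {m} → RawMatroid (suc m) → Fin (suc m) → RawMatroid m

∂-summand : Selector → Minor → ∀ {m} → RawMatroid (suc m) → Sign → Fin (suc m) → Term
∂-summand sel op M s x = if sel M x then gen (op M x) (ιsign x s) else 0ᵗ

∂-gen : ∀ (sel : Selector) (op : Minor) {m} (M : RawMatroid (suc m)) s → ∂[ sel , op ] (gen M s) ≡ ∑ᵗ (∂-summand sel op M s)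
∂-gen sel op {m} M s = foldr-allFinL +ᵗ-commutativeMonoid (suc m) (∂-summand sel op M s)

gen-cong : ∀ {n} {M M′ : RawMatroid n} s → (∀ I → indep M′ I ≡ indep M I) → gen M s ≈ gen M′ s
gen-cong {n} {M} {M′} s M≗M′ = trans′
  (rel-iso M M′ Permutation.id s λ I → trans (cong (indep M′) (tabulate∘lookup I)) (M≗M′ I))
  (≡⇒≈ (cong (λ σ → gen M′ (σ *ˢ s)) (sgn-id {n})))

module _ (sel : Selector) (op : Minor)
  (sel-iso : ∀ {m} (ψ : Permutation′ (suc m)) {M M′} → IsIso ψ M M′ → ∀ x → sel M′ (ψ ⟨$⟩ʳ x) ≡ sel M x)
  (op-iso : ∀ {m} (ψ : Permutation′ (suc m)) {M M′} → IsIso ψ M M′ → ∀ x → IsIso (remove x ψ) (op M x) (op M′ (ψ ⟨$⟩ʳ x)))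
  where

  private
    ∂ = ∂[ sel , op ]

  ∂-opposite : ∀ {m} (M : RawMatroid (suc m)) s → ∂ (gen M (Sign.opposite s)) ≈ (- 1ℚ) • ∂ (gen M s)
  ∂-opposite M s = begin
    ∂ (gen M (Sign.opposite s))                  ≡⟨ ∂-gen sel op M (Sign.opposite s) ⟩
    ∑ᵗ (∂-summand sel op M (Sign.opposite s))    ≈⟨ ∑ᵗ-cong opposite-summand ⟩
    ∑ᵗ (λ x → (- 1ℚ) • ∂-summand sel op M s x)   ≈⟨ •-∑ᵗ (- 1ℚ) (∂-summand sel op M s) ⟨
    (- 1ℚ) • ∑ᵗ (∂-summand sel op M s)           ≡⟨ cong ((- 1ℚ) •_) (∂-gen sel op M s) ⟨
    (- 1ℚ) • ∂ (gen M s)                         ∎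
    where
    open ≈-Reasoning
    opposite-summand : ∀ x → ∂-summand sel op M (Sign.opposite s) x ≈ (- 1ℚ) • ∂-summand sel op M s x
    opposite-summand x = if-• (sel M x) (- 1ℚ)
      (trans′ (≡⇒≈ (cong (gen (op M x)) (ιsign-opposite x s))) (rel-orient (op M x) (ιsign x s)))

  ∂-iso : ∀ {m} (M M′ : RawMatroid (suc m)) (ψ : Permutation′ (suc m)) s → IsIso ψ M M′ →
          ∂ (gen M s) ≈ ∂ (gen M′ (sgn ψ *ˢ s))
  ∂-iso M M′ ψ s iso = begin
    ∂ (gen M s)                                          ≡⟨ ∂-gen sel op M s ⟩
    ∑ᵗ (∂-summand sel op M s)                            ≈⟨ ∑ᵗ-cong iso-summand ⟩
    ∑ᵗ (∂-summand sel op M′ (sgn ψ *ˢ s) ∘ (ψ ⟨$⟩ʳ_))    ≈⟨ ∑ᵗ-permute (∂-summand sel op M′ (sgn ψ *ˢ s)) ψ ⟨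
    ∑ᵗ (∂-summand sel op M′ (sgn ψ *ˢ s))                ≡⟨ ∂-gen sel op M′ (sgn ψ *ˢ s) ⟨
    ∂ (gen M′ (sgn ψ *ˢ s))                              ∎
    where
    open ≈-Reasoning
    iso-summand : ∀ x → ∂-summand sel op M s x ≈ ∂-summand sel op M′ (sgn ψ *ˢ s) (ψ ⟨$⟩ʳ x)
    iso-summand x = if-≈ (sym (sel-iso ψ iso x)) λ _ →
      trans′ (rel-iso (op M x) (op M′ (ψ ⟨$⟩ʳ x)) (remove x ψ) (ιsign x s) (op-iso ψ iso x))
             (≡⇒≈ (cong (gen (op M′ (ψ ⟨$⟩ʳ x))) (ιsign-remove ψ x s)))

  ∂-cong : ∀ {t u} → t ≈ u → ∂ t ≈ ∂ u
  ∂-cong refl′                              = refl′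
  ∂-cong (sym′ p)                           = sym′ (∂-cong p)
  ∂-cong (trans′ p q)                       = trans′ (∂-cong p) (∂-cong q)
  ∂-cong (+-cong p q)                       = +-cong (∂-cong p) (∂-cong q)
  ∂-cong (•-cong p)                         = •-cong (∂-cong p)
  ∂-cong +-assoc                            = +-assoc
  ∂-cong +-comm                             = +-comm
  ∂-cong +-idʳ                              = +-idʳ
  ∂-cong +-invʳ                             = +-invʳ
  ∂-cong •-distˡ                            = •-distˡ
  ∂-cong •-distʳ                            = •-distʳ
  ∂-cong •-assoc                            = •-assoc
  ∂-cong •-one                              = •-one
  ∂-cong (rel-orient {zero} M s)            = sym′ •-zeroʳ
  ∂-cong (rel-orient {suc m} M s)           = ∂-opposite M s
  ∂-cong (rel-iso {zero} M M′ ψ s iso)      = refl′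
  ∂-cong (rel-iso {suc m} M M′ ψ s iso)     = ∂-iso M M′ ψ s iso

dualMap-cong : ∀ {t u} → t ≈ u → dualMap t ≈ dualMap u
dualMap-cong refl′                         = refl′
dualMap-cong (sym′ p)                      = sym′ (dualMap-cong p)
dualMap-cong (trans′ p q)                  = trans′ (dualMap-cong p) (dualMap-cong q)
dualMap-cong (+-cong p q)                  = +-cong (dualMap-cong p) (dualMap-cong q)
dualMap-cong (•-cong p)                    = •-cong (dualMap-cong p)
dualMap-cong +-assoc                       = +-assoc
dualMap-cong +-comm                        = +-comm
dualMap-cong +-idʳ                         = +-idʳ
dualMap-cong +-invʳ                        = +-invʳ
dualMap-cong •-distˡ                       = •-distˡ
dualMap-cong •-distʳ                       = •-distʳ
dualMap-cong •-assoc                       = •-assoc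
dualMap-cong •-one                         = •-one
dualMap-cong (rel-orient M s)              = rel-orient (dual M) s
dualMap-cong (rel-iso M M′ ψ s iso)        = rel-iso (dual M) (dual M′) ψ s (dual-iso ψ iso)

dualMap-involutive : ∀ {u} → Over IsMatroid u → dualMap (dualMap u) ≈ u
dualMap-involutive 0ᵗ            = refl′
dualMap-involutive (gen s isM)   = sym′ (gen-cong s (dual-involutive isM))
dualMap-involutive (a +ᵗ b)      = +-cong (dualMap-involutive a) (dualMap-involutive b)
dualMap-involutive (q • a)       = •-cong (dualMap-involutive a)

module _ (sel sel′ : Selector) (op op′ : Minor)
  (sel-dual : ∀ {m} {M : RawMatroid (suc m)} → IsMatroid M → ∀ x → sel M x ≡ sel′ (dual M) x)
  (op-dual : ∀ {m} {M : RawMatroid (suc m)} → IsMatroid M → ∀ x I → indep (op′ (dual M) x) I ≡ indep (dual (op M x)) I)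
  where

  dualMap-∂ : ∀ {u} → Over IsMatroid u → dualMap (∂[ sel , op ] u) ≈ ∂[ sel′ , op′ ] (dualMap u)
  dualMap-∂ 0ᵗ                        = refl′
  dualMap-∂ (gen {zero} s _)          = refl′
  dualMap-∂ (gen {suc m} {M} s isM)   = begin
    dualMap (∂[ sel , op ] (gen M s))     ≡⟨ cong dualMap (∂-gen sel op M s) ⟩
    dualMap (∑ᵗ (∂-summand sel op M s))   ≡⟨ dualMap-∑ᵗ (∂-summand sel op M s) ⟩
    ∑ᵗ (dualMap ∘ ∂-summand sel op M s)   ≈⟨ ∑ᵗ-cong dual-summand ⟩
    ∑ᵗ (∂-summand sel′ op′ (dual M) s)    ≡⟨ ∂-gen sel′ op′ (dual M) s ⟨
    ∂[ sel′ , op′ ] (gen (dual M) s)      ∎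
    where
    open ≈-Reasoning
    dual-summand : ∀ x → dualMap (∂-summand sel op M s x) ≈ ∂-summand sel′ op′ (dual M) s x
    dual-summand x = trans′ (≡⇒≈ (if-float dualMap (sel M x)))
      (if-≈ (sel-dual isM x) λ _ → gen-cong (ιsign x s) (op-dual isM x))
  dualMap-∂ (a +ᵗ b)                  = +-cong (dualMap-∂ a) (dualMap-∂ b)
  dualMap-∂ (q • a)                   = •-cong (dualMap-∂ a)

Over-map : ∀ {Q Q′ : GenPred} → (∀ {n} {M : RawMatroid n} → Q M → Q′ M) → ∀ {u} → Over Q u → Over Q′ u
Over-map f 0ᵗ        = 0ᵗ
Over-map f (gen s q) = gen s (f q)
Over-map f (a +ᵗ b)  = Over-map f a +ᵗ Over-map f b
Over-map f (q • a)   = q • Over-map f a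

Over-dualMap : ∀ {Q Q′ : GenPred} → (∀ {n} {M : RawMatroid n} → Q M → Q′ (dual M)) → ∀ {u} → Over Q u → Over Q′ (dualMap u)
Over-dualMap f 0ᵗ        = 0ᵗ
Over-dualMap f (gen s q) = gen s (f q)
Over-dualMap f (a +ᵗ b)  = Over-dualMap f a +ᵗ Over-dualMap f b
Over-dualMap f (q • a)   = q • Over-dualMap f a

Over-∑ᵗ : ∀ {Q : GenPred} {n} {g : Fin n → Term} → (∀ x → Over Q (g x)) → Over Q (∑ᵗ g)
Over-∑ᵗ {n = zero}  _ = 0ᵗ
Over-∑ᵗ {n = suc n} h = h zero +ᵗ Over-∑ᵗ (h ∘ suc)

Over-∂ : ∀ (sel : Selector) (op : Minor) {Q Q′ : GenPred} →
         (∀ {m} {M : RawMatroid (suc m)} → Q M → ∀ x → sel M x ≡ true → Q′ (op M x)) →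
         ∀ {u} → Over Q u → Over Q′ (∂[ sel , op ] u)
Over-∂ sel op f 0ᵗ                     = 0ᵗ
Over-∂ sel op f (gen {zero} s q)       = 0ᵗ
Over-∂ sel op {Q′ = Q′} f (gen {suc m} {M} s q) rewrite ∂-gen sel op M s = Over-∑ᵗ λ x → over-summand x (sel M x) refl
  where
  over-summand : ∀ x b → sel M x ≡ b → Over Q′ (∂-summand sel op M s x)
  over-summand x true  e rewrite e = gen (ιsign x s) (f q x e)
  over-summand x false e rewrite e = 0ᵗ
Over-∂ sel op f (a +ᵗ b)               = Over-∂ sel op f a +ᵗ Over-∂ sel op f b
Over-∂ sel op f (q • a)                = q • Over-∂ sel op f a

InSpan-map : ∀ {Q Q′ : GenPred} (f : Term → Term) → (∀ {t u} → t ≈ u → f t ≈ f u) →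
             (∀ {u} → Over Q u → Over Q′ (f u)) → ∀ {t} → InSpan Q t → InSpan Q′ (f t)
InSpan-map f f-cong f-over (u , t≈u , over-u) = f u , f-cong t≈u , f-over over-u

module _ {m} (N : RawMatroid m) (M : RawMatroid (suc m)) where

  grading-same-rank : rank N ≡ rank M → nullity N ≡ nullity M ∸ 1 × rank N ≡ rank M
  grading-same-rank e = trans (cong (m ∸_) e) m∸r≡[1+m∸r]∸1 , e
    where
    m∸r≡[1+m∸r]∸1 : m ∸ rank M ≡ (suc m ∸ rank M) ∸ 1
    m∸r≡[1+m∸r]∸1 = sym (trans (∸-+-assoc (suc m) (rank M) 1) (cong (suc m ∸_) (ℕ.+-comm (rank M) 1)))

  grading-rank-drop : suc (rank N) ≡ rank M → nullity N ≡ nullity M × rank N ≡ rank M ∸ 1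
  grading-rank-drop e = cong (suc m ∸_) e , cong (_∸ 1) e

module _ {m} {M : RawMatroid (suc m)} (isM : IsMatroid M) (x : Fin (suc m)) where

  ∖-grading-noncoloop : coloop M x ≡ false → nullity (M ∖ x) ≡ nullity M ∸ 1 × rank (M ∖ x) ≡ rank M
  ∖-grading-noncoloop e = grading-same-rank (M ∖ x) M (rank-∖-noncoloop isM x e)

  ∖-grading-coloop : coloop M x ≡ true → nullity (M ∖ x) ≡ nullity M × rank (M ∖ x) ≡ rank M ∸ 1
  ∖-grading-coloop e = grading-rank-drop (M ∖ x) M (rank-∖-coloop isM x e)

  ／-grading-loop : loop M x ≡ true → nullity (M ／ x) ≡ nullity M ∸ 1 × rank (M ／ x) ≡ rank M
  ／-grading-loop e = grading-same-rank (M ／ x) M (rank-／-loop isM x e)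

  ／-grading-nonloop : loop M x ≡ false → nullity (M ／ x) ≡ nullity M × rank (M ／ x) ≡ rank M ∸ 1
  ／-grading-nonloop e = grading-rank-drop (M ／ x) M (rank-／-nonloop isM x e)

∂del-cong : ∀ {t u} → t ≈ u → ∂del t ≈ ∂del u
∂del-cong = ∂-cong _ _ (λ ψ {M} {M′} iso x → cong not (coloop-iso ψ {M} {M′} iso x))
                       (λ ψ {M} {M′} iso x → minor-iso ψ {M} {M′} iso x false)

∂clp-cong : ∀ {t u} → t ≈ u → ∂clp t ≈ ∂clp u
∂clp-cong = ∂-cong _ _ coloop-iso (λ ψ {M} {M′} iso x → minor-iso ψ {M} {M′} iso x false)

∂con-cong : ∀ {t u} → t ≈ u → ∂con t ≈ ∂con u
∂con-cong = ∂-cong _ _ (λ ψ {M} {M′} iso x → cong not (loop-iso ψ {M} {M′} iso x)) ／-iso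

∂lp-cong : ∀ {t u} → t ≈ u → ∂lp t ≈ ∂lp u
∂lp-cong = ∂-cong _ _ loop-iso ／-iso

Graded : Property → ℕ → ℕ → GenPred
Graded P k r M = HasP P M × nullity M ≡ k × rank M ≡ r

deletion-subcomplex : (P : Property) → DeletionClosed P → ∀ k r t → (𝓜[ P ] k , r) t →
                      (𝓜[ P ] (k ∸ 1) , r) (∂del t) × (𝓜[ P ] k , (r ∸ 1)) (∂clp t)
deletion-subcomplex P closed k r t t∈ =
  InSpan-map ∂del ∂del-cong (Over-∂ _ _ del-noncoloop) t∈ , InSpan-map ∂clp ∂clp-cong (Over-∂ _ _ del-coloop) t∈
  where
  del-noncoloop : ∀ {m} {M : RawMatroid (suc m)} → Graded P k r M → ∀ x → not (coloop M x) ≡ true → Graded P (k ∸ 1) r (M ∖ x)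
  del-noncoloop {M = M} ((isM , p) , n≡k , r≡r) x e with ∖-grading-noncoloop isM x (not-true⁻ e)
  ... | n′ , r′ = (∖-isMatroid isM x , closed (M , isM) x _ p) , trans n′ (cong (_∸ 1) n≡k) , trans r′ r≡r
  del-coloop : ∀ {m} {M : RawMatroid (suc m)} → Graded P k r M → ∀ x → coloop M x ≡ true → Graded P k (r ∸ 1) (M ∖ x)
  del-coloop {M = M} ((isM , p) , n≡k , r≡r) x e with ∖-grading-coloop isM x e
  ... | n′ , r′ = (∖-isMatroid isM x , closed (M , isM) x _ p) , trans n′ n≡k , trans r′ (cong (_∸ 1) r≡r)

contraction-subcomplex : (P : Property) → ContractionClosed P → ∀ k r t → (𝓜[ P ] k , r) t →
                         (𝓜[ P ] (k ∸ 1) , r) (∂lp t) × (𝓜[ P ] k , (r ∸ 1)) (∂con t)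
contraction-subcomplex P closed k r t t∈ =
  InSpan-map ∂lp ∂lp-cong (Over-∂ _ _ con-loop) t∈ , InSpan-map ∂con ∂con-cong (Over-∂ _ _ con-nonloop) t∈
  where
  con-loop : ∀ {m} {M : RawMatroid (suc m)} → Graded P k r M → ∀ x → loop M x ≡ true → Graded P (k ∸ 1) r (M ／ x)
  con-loop {M = M} ((isM , p) , n≡k , r≡r) x e with ／-grading-loop isM x e
  ... | n′ , r′ = (／-isMatroid isM x , closed (M , isM) x _ p) , trans n′ (cong (_∸ 1) n≡k) , trans r′ r≡r
  con-nonloop : ∀ {m} {M : RawMatroid (suc m)} → Graded P k r M → ∀ x → not (loop M x) ≡ true → Graded P k (r ∸ 1) (M ／ x)
  con-nonloop {M = M} ((isM , p) , n≡k , r≡r) x e with ／-grading-nonloop isM x (not-true⁻ e)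
  ... | n′ , r′ = (／-isMatroid isM x , closed (M , isM) x _ p) , trans n′ n≡k , trans r′ (cong (_∸ 1) r≡r)

／-dual≗dual-∖ : ∀ {m} {M : RawMatroid (suc m)} → IsMatroid M → ∀ x I → indep (dual M ／ x) I ≡ indep (dual (M ∖ x)) I
／-dual≗dual-∖ isM x I = trans (indep-dual-／ isM x I) (sym (indep-dual-∖ isM x I))

dualMap-∂del-Over : ∀ {u} → Over IsMatroid u → dualMap (∂del u) ≈ ∂con (dualMap u)
dualMap-∂del-Over = dualMap-∂ _ _ _ _ (λ isM x → cong not (coloop≡loop-dual isM x)) ／-dual≗dual-∖

dualMap-∂clp-Over : ∀ {u} → Over IsMatroid u → dualMap (∂clp u) ≈ ∂lp (dualMap u)
dualMap-∂clp-Over = dualMap-∂ _ _ _ _ coloop≡loop-dual ／-dual≗dual-∖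

module _ {Q : GenPred} (isMatroid : ∀ {n} {M : RawMatroid n} → Q M → IsMatroid M) where

  InSpan-dualMap-involutive : ∀ {t} → InSpan Q t → dualMap (dualMap t) ≈ t
  InSpan-dualMap-involutive (u , t≈u , over-u) =
    trans′ (dualMap-cong (dualMap-cong t≈u)) (trans′ (dualMap-involutive (Over-map isMatroid over-u)) (sym′ t≈u))

  InSpan-dualMap-injective : ∀ {t u} → InSpan Q t → InSpan Q u → dualMap t ≈ dualMap u → t ≈ u
  InSpan-dualMap-injective t∈ u∈ e =
    trans′ (sym′ (InSpan-dualMap-involutive t∈)) (trans′ (dualMap-cong e) (InSpan-dualMap-involutive u∈))

  InSpan-dualMap-onto : ∀ {Q′ : GenPred} → (∀ {n} {M : RawMatroid n} → Q M → Q′ (dual M)) →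
                        ∀ {u} → InSpan Q u → Σ Term λ t → InSpan Q′ t × dualMap t ≈ u
  InSpan-dualMap-onto toQ′ (u′ , u≈u′ , over-u′) =
    dualMap u′ , (dualMap u′ , refl′ , Over-dualMap toQ′ over-u′) ,
    trans′ (InSpan-dualMap-involutive (u′ , refl′ , over-u′)) (sym′ u≈u′)

  InSpan-dualMap-∂ : ∀ {t} → InSpan Q t → (dualMap (∂del t) ≈ ∂con (dualMap t)) × (dualMap (∂clp t) ≈ ∂lp (dualMap t))
  InSpan-dualMap-∂ (u , t≈u , over-u) =
    trans′ (dualMap-cong (∂del-cong t≈u)) (trans′ (dualMap-∂del-Over over-u′) (sym′ (∂con-cong (dualMap-cong t≈u)))) ,
    trans′ (dualMap-cong (∂clp-cong t≈u)) (trans′ (dualMap-∂clp-Over over-u′) (sym′ (∂lp-cong (dualMap-cong t≈u))))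
    where
    over-u′ = Over-map isMatroid over-u

module _ (P : Property) where

  dual-HasP : IsoStable P → ∀ {n} {M : RawMatroid n} → HasP P M → HasP (P *) (dual M)
  dual-HasP isoP {M = M} (isM , p) = dual-isMatroid isM , dual-isMatroid (dual-isMatroid isM) ,
    isoP (M , isM) (dual (dual M) , _) Permutation.id
      (λ I → trans (cong (indep (dual (dual M))) (tabulate∘lookup I)) (dual-involutive isM I)) p

  dual-Graded : IsoStable P → ∀ {k r n} {M : RawMatroid n} → Graded P k r M → Graded (P *) r k (dual M)
  dual-Graded isoP ((isM , p) , n≡k , r≡r) = dual-HasP isoP (isM , p) , trans (nullity-dual isM) r≡r , trans (rank-dual isM) n≡k

  Graded*-dual : ∀ {k r n} {M : RawMatroid n} → Graded (P *) r k M → Graded P k r (dual M)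
  Graded*-dual ((isM , h , p) , n≡r , r≡k) = (h , p) , trans (nullity-dual isM) r≡k , trans (rank-dual isM) n≡r

proposition3p14 :
  (P : Property) → IsoStable P →
  -- (1) deletion closed: 𝓜^P is a sub-bicomplex for (∂del , ∂clp)
  (DeletionClosed P →
    ∀ k r t → (𝓜[ P ] k , r) t →
      (𝓜[ P ] (k ∸ 1) , r) (∂del t) × (𝓜[ P ] k , (r ∸ 1)) (∂clp t))
  ×
  -- (2) contraction closed: 𝓜^P is a sub-bicomplex for (∂lp , ∂con)
  (ContractionClosed P →
    ∀ k r t → (𝓜[ P ] k , r) t →
      (𝓜[ P ] (k ∸ 1) , r) (∂lp t) × (𝓜[ P ] k , (r ∸ 1)) (∂con t))
  ×
  -- (3) [M , η] ↦ [M* , η] is a grading-transposing isomorphism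
  --     (𝓜^P , ∂del , ∂clp) → (𝓜^{P*} , ∂lp , ∂con)
  (DeletionClosed P →
    -- well defined on classes
    (∀ t u → 𝓜 P t → 𝓜 P u → t ≈ u → dualMap t ≈ dualMap u)
    -- injective
    × (∀ t u → 𝓜 P t → 𝓜 P u → dualMap t ≈ dualMap u → t ≈ u)
    -- φ (𝓜^P_{k,r}) = 𝓜^{P*}_{r,k}
    × (∀ k r t → (𝓜[ P ] k , r) t → (𝓜[ P * ] r , k) (dualMap t))
    × (∀ k r u → (𝓜[ P * ] r , k) u →
         Σ Term λ t → (𝓜[ P ] k , r) t × dualMap t ≈ u)
    -- φ (𝓜^P) = 𝓜^{P*}
    × (∀ u → 𝓜 (P *) u → Σ Term λ t → 𝓜 P t × dualMap t ≈ u)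
    -- φ ∘ ∂del = ∂con ∘ φ  and  φ ∘ ∂clp = ∂lp ∘ φ
    × (∀ t → 𝓜 P t →
         (dualMap (∂del t) ≈ ∂con (dualMap t))
         × (dualMap (∂clp t) ≈ ∂lp (dualMap t))))
proposition3p14 P isoP =
  deletion-subcomplex P ,
  contraction-subcomplex P ,
  -- (3) holds without P being deletion closed.
  λ _ →
    (λ _ _ _ _ → dualMap-cong) ,
    (λ _ _ → InSpan-dualMap-injective proj₁) ,
    (λ _ _ _ → InSpan-map dualMap dualMap-cong (Over-dualMap (dual-Graded P isoP))) ,
    (λ _ _ _ → InSpan-dualMap-onto (proj₁ ∘ proj₁) (Graded*-dual P)) ,
    (λ _ → InSpan-dualMap-onto proj₁ λ (_ , isM* , p) → isM* , p) ,
    (λ _ → InSpan-dualMap-∂ proj₁)
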